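{- Let $k\geq 3$, $n_1,\dots,n_k\geq 2$, $r\in\{1,\dots,k\}$, and let $CS^r_{n_1,\dots,n_k}$ be the clique-star with cliques $V_1,\dots,V_k$, $|V_i|=n_i$, and center clique $V_r$. Let $j$ be an index with $n_j=\min\{n_1,\dots,n_k\}$ and let $$f(k,n_j)=(n_j-1)(k-1)+\tfrac{(n_j-2)(n_j-1)}{2}-\tfrac{(k-2)(k-1)}{2}.$$ Let $G\in\mathcal{O}(CS^r_{n_1,\dots,n_k})$ have the minimum number of edges among all graphs in $\mathcal{O}(CS^r_{n_1,\dots,n_k})$, with split decomposition $Q_0,Q_1,\dots,Q_k$. Then: (1) If $k$ is even, then $Q_0$ is a star pointing towards $Q_j$, $Q_j$ is star-center, all other $Q_i$ ($i\neq0,j$) are star-spoke, and $|E(G)|=n_j(k-1)+\sum_{i\neq j}(n_i-1)$. (2) If $k$ is odd and $f(k,n_j)>0$, then $Q_0$ is complete and all $Q_i$ ($i\geq 1$) are star-spoke (so $G$ is a multi-leaf repeater graph), and $|E(G)|=\frac{k(k-1)}{2}+\sum_{i=1}^k(n_i-1)$. (3) If $k$ is odd and $f(k,n_j)<0$, then $Q_0$ is a star pointing towards $Q_j$, $Q_j$ is complete, all other $Q_i$ ($i\neq0,j$) are star-spoke, and $|E(G)|=n_j(k-1)+\frac{n_j(n_j-1)}{2}+\sum_{i\neq j}(n_i-1)$. If $f(k,n_j)=0$, the graphs described in (2) and (3) have the same number of edges and both are minimal in the LC orbit.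
   Context: Local complement $c_v(G)$: replace the subgraph induced on the neighbourhood of $v$ by its complement, leaving all other edges unchanged; $\mathcal{O}(G)$ is the set of graphs on the same labeled vertex set obtainable from $G$ by finite sequences of local complements. Clique-star $CS^r$: each $V_i$ is a clique, all vertices of $V_r$ are adjacent to all vertices of every $V_i$ ($i\neq r$), and no other edges. Split decomposition of graphs in this orbit: every $G\in\mathcal{O}(CS^r_{n_1,\dots,n_k})$ is described by quotient graphs $Q_0,Q_1,\dots,Q_k$, where $Q_i$ ($i\geq1$) has vertex set $V_i$ (leaf-nodes) plus one split-node $s_i$, $Q_0$ has $k$ split-nodes $t_1,\dots,t_k$, and each quotient graph is complete or a star. $G$ is reconstructed as follows: two vertices of $V_i$ are adjacent in $G$ iff adjacent in $Q_i$; $u\in V_i$, $v\in V_\ell$ ($i\neq\ell$) are adjacent in $G$ iff $us_i\in E(Q_i)$, $t_it_\ell\in E(Q_0)$ and $s_\ell v\in E(Q_\ell)$. Terminology: $Q_i$ ($i\geq1$) is complete; star-center if it is a star with center $s_i$; star-spoke if it is a star whose center is a leaf-node. $Q_0$ is complete, or a star "pointing towards $Q_j$", i.e. with center $t_j$. A multi-leaf repeater graph is $K_k$ on $w_1,\dots,w_k$ with $n_i-1$ extra pendant leaves attached to $w_i$. -}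

module Defs where

open import Data.Nat using (ℕ; zero; suc; _+_; _*_; _∸_; _≤_; _<ᵇ_; _≡ᵇ_)
open import Data.Nat.DivMod using (_/_)
open import Data.Integer using (ℤ; +_) renaming (_-_ to _-ℤ_)
open import Data.Fin using (Fin; toℕ; _≟_)
open import Data.Bool using (Bool; true; false; not; _∧_; _∨_; if_then_else_)
open import Data.List using (List; []; _∷_; map; concatMap; length; filter; foldl; allFin)
open import Data.Nat.ListAction using (sum)
import Data.Bool as B
open import Data.Product using (Σ; ∃; _×_; _,_; proj₁; proj₂)
open import Data.Product.Properties using (≡-dec)
open import Relation.Nullary using (Dec; yes; no; ¬_; does)
open import Relation.Binary.PropositionalEquality using (_≡_; refl)

-- Labeled vertex set V_1 ⊔ … ⊔ V_k, |V_i| = n i.  Vertex (i , a) is the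
-- a-th vertex of the part V_i.

Vtx : (k : ℕ) → (Fin k → ℕ) → Set
Vtx k n = Σ (Fin k) (λ i → Fin (n i))

_≟V_ : ∀ {k n} → (u w : Vtx k n) → Dec (u ≡ w)
_≟V_ = ≡-dec _≟_ _≟_

allV : (k : ℕ) (n : Fin k → ℕ) → List (Vtx k n)
allV k n = concatMap (λ i → map (λ a → (i , a)) (allFin (n i))) (allFin k)

Graph : (k : ℕ) → (Fin k → ℕ) → Set
Graph k n = Vtx k n → Vtx k n → Bool

_≈G_ : ∀ {k n} → Graph k n → Graph k n → Set
G ≈G H = ∀ u w → G u w ≡ H u w

lc : ∀ {k n} → Vtx k n → Graph k n → Graph k n
lc v G u w =
  if (not (does (u ≟V w)) ∧ G v u ∧ G v w) then not (G u w) else G u w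

lcs : ∀ {k n} → List (Vtx k n) → Graph k n → Graph k n
lcs vs G = foldl (λ H v → lc v H) G vs

_∈Orbit_ : ∀ {k n} → Graph k n → Graph k n → Set
_∈Orbit_ {k} {n} H G = Σ (List (Vtx k n)) (λ vs → H ≈G lcs vs G)

-- strict linear order on vertices (lexicographic), to count unordered pairs
_<V_ : ∀ {k n} → Vtx k n → Vtx k n → Bool
(i , a) <V (j , b) =
  (toℕ i <ᵇ toℕ j) ∨ ((toℕ i ≡ᵇ toℕ j) ∧ (toℕ a <ᵇ toℕ b))

edges : ∀ {k n} → Graph k n → ℕ
edges {k} {n} G =
  length (filter (λ p → (proj₁ p <V proj₂ p ∧ G (proj₁ p) (proj₂ p)) B.≟ true)
    (concatMap (λ u → map (λ w → (u , w)) (allV k n)) (allV k n)))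

CS : (k : ℕ) (n : Fin k → ℕ) (r : Fin k) → Graph k n
CS k n r u w with u ≟V w
... | yes _ = false
... | no _ = does (proj₁ u ≟ proj₁ w) ∨ does (proj₁ u ≟ r) ∨ does (proj₁ w ≟ r)

-- Q_0 on split-nodes t_1..t_k: complete, or a star pointing towards Q_j
data Q0Type (k : ℕ) : Set where
  complete  : Q0Type k
  starTowards : Fin k → Q0Type k

-- Q_i on V_i ∪ {s_i}: complete, star-center (center s_i),
-- or star-spoke with center the leaf-node c ∈ V_i
data QiType (m : ℕ) : Set where
  complete   : QiType m
  starCenter : QiType m
  starSpoke  : Fin m → QiType m

record SplitDec (k : ℕ) (n : Fin k → ℕ) : Set where
  constructor splitDec
  field
    Q0 : Q0Type k
    Q  : (i : Fin k) → QiType (n i)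
open SplitDec public

leafAdj : ∀ {m} → QiType m → Fin m → Fin m → Bool
leafAdj complete      a b = not (does (a ≟ b))
leafAdj starCenter    a b = false
leafAdj (starSpoke c) a b = not (does (a ≟ b)) ∧ (does (a ≟ c) ∨ does (b ≟ c))

-- adjacency of leaf-node a with the split-node s_i in Q_i
splitAdj : ∀ {m} → QiType m → Fin m → Bool
splitAdj complete      a = true
splitAdj starCenter    a = true
splitAdj (starSpoke c) a = does (a ≟ c)

q0Adj : ∀ {k} → Q0Type k → Fin k → Fin k → Bool
q0Adj complete        i l = not (does (i ≟ l))
q0Adj (starTowards j) i l = not (does (i ≟ l)) ∧ (does (i ≟ j) ∨ does (l ≟ j))

reconstruct : ∀ {k n} → SplitDec k n → Graph k n
reconstruct {k} {n} D (i , a) (l , b) with i ≟ l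
... | yes refl = leafAdj (Q D i) a b
... | no _ = splitAdj (Q D i) a ∧ q0Adj (Q0 D) i l ∧ splitAdj (Q D l) b

HasSplitDec : ∀ {k n} → Graph k n → SplitDec k n → Set
HasSplitDec G D = G ≈G reconstruct D

IsStarSpoke : ∀ {m} → QiType m → Set
IsStarSpoke {m} q = Σ (Fin m) (λ c → q ≡ starSpoke c)

sumFin : (k : ℕ) → (Fin k → ℕ) → ℕ
sumFin k g = sum (map g (allFin k))

sumExcept : (k : ℕ) → Fin k → (Fin k → ℕ) → ℕ
sumExcept k j g = sumFin k (λ i → if does (i ≟ j) then 0 else g i)

-- f(k, m) = (m-1)(k-1) + (m-2)(m-1)/2 - (k-2)(k-1)/2   (exact divisions)
f : ℕ → ℕ → ℤ
f k m = + ((m ∸ 1) * (k ∸ 1) + ((m ∸ 2) * (m ∸ 1)) / 2) -ℤ + (((k ∸ 2) * (k ∸ 1)) / 2)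

Shape1 : ∀ {k n} → Fin k → SplitDec k n → Set
Shape1 {k} j D = (Q0 D ≡ starTowards j) × (Q D j ≡ starCenter)
  × (∀ (i : Fin k) → ¬ (i ≡ j) → IsStarSpoke (Q D i))

Shape2 : ∀ {k n} → SplitDec k n → Set
Shape2 {k} D = (Q0 D ≡ complete) × (∀ (i : Fin k) → IsStarSpoke (Q D i))

Shape3 : ∀ {k n} → Fin k → SplitDec k n → Set
Shape3 {k} j D = (Q0 D ≡ starTowards j) × (Q D j ≡ complete)
  × (∀ (i : Fin k) → ¬ (i ≡ j) → IsStarSpoke (Q D i))

module Submission where

-- Local complementation at a vertex of V_i acts on split decompositions by local complementations
-- of the quotient graphs, so every graph in the orbit of CS^r has a decomposition of an admissible
-- shape in which the number of star-spoke quotients has a prescribed parity; since k ≥ 3 and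
-- n_i ≥ 2 the decomposition is unique, so this is the given decomposition of G.  Twice the
-- number of edges is a sum over the quotients of their inner arcs plus their split-degree times
-- the number of vertices reached through Q_0.  This yields a lower bound for each admissible
-- shape, attained exactly by (1), (2) or (3), and explicit sequences of local complements reach
-- these shapes.  The parity of k decides whether Q_0 is a star, and for odd k the sign of
-- f(k, n_j) compares (2) with (3).

module CliqueStarOrbit where
  open import Data.Bool using (Bool; true; false; if_then_else_; not; _∧_; _∨_)
  import Data.Bool as Bool
  open import Data.Bool.Properties using (∨-comm; ∧-zeroʳ; ∧-identityʳ; ∧-conicalˡ; not-involutive; ¬-not)
  open import Data.Empty using (⊥; ⊥-elim)
  open import Data.Fin using (Fin; zero; suc; _≟_; toℕ)
  open import Data.Fin.Properties using (toℕ-injective; any?)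
  import Data.Integer as ℤ
  import Data.Integer.Properties as ℤP
  open import Data.List using (List; []; _∷_; _++_; map; concatMap; tabulate; allFin; filter; length)
  open import Data.List.Membership.Propositional using (_∈_)
  open import Data.List.Membership.Propositional.Properties using (∈-allFin)
  open import Data.List.Properties using (map-tabulate)
  open import Data.List.Relation.Unary.Any using (here; there)
  open import Data.Nat hiding (_≟_)
  open import Data.Nat.DivMod using (_/_; m*n/n≡m; [m+n]%n≡m%n)
  open import Data.Nat.ListAction using (sum)
  open import Data.Nat.Properties hiding (_≟_)
  open import Data.Nat.Tactic.RingSolver using (solve-∀)
  open import Data.Product using (Σ; ∃; _×_; _,_; proj₁; proj₂)
  open import Data.Sum using (_⊎_; inj₁; inj₂)
  open import Function using (_∘_; id; mk⇔)
  open import Relation.Binary.Definitions using (tri<; tri≈; tri>)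
  open import Relation.Binary.PropositionalEquality
  open import Relation.Nullary using (Dec; yes; no; does; ¬_)
  open import Relation.Nullary.Decidable using (dec-true; dec-false; does-⇔; _×-dec_; ¬?)
  open import Defs

  ⟦_⟧ : Bool → ℕ
  ⟦ true ⟧ = 1
  ⟦ false ⟧ = 0

  ⟦∧⟧ : ∀ a b → ⟦ a ∧ b ⟧ ≡ ⟦ a ⟧ * ⟦ b ⟧
  ⟦∧⟧ true b = sym (+-identityʳ ⟦ b ⟧)
  ⟦∧⟧ false b = refl

  true≢false : true ≢ false
  true≢false ()

  _==_ : ∀ {k} → Fin k → Fin k → Bool
  i == j = does (i ≟ j)

  ==-refl : ∀ {k} (i : Fin k) → (i == i) ≡ true
  ==-refl i = dec-true (i ≟ i) refl

  ≢⇒==-false : ∀ {k} {i j : Fin k} → i ≢ j → (i == j) ≡ false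
  ≢⇒==-false {i = i} {j} = dec-false (i ≟ j)

  ==-sym : ∀ {k} (i j : Fin k) → (i == j) ≡ (j == i)
  ==-sym i j = does-⇔ (mk⇔ sym sym) (i ≟ j) (j ≟ i)

  ∑ : (k : ℕ) → (Fin k → ℕ) → ℕ
  ∑ zero g = 0
  ∑ (suc k) g = g zero + ∑ k (g ∘ suc)

  except : ∀ {k} → Fin k → (Fin k → ℕ) → Fin k → ℕ
  except j g i = if i == j then 0 else g i

  sumFin≡∑ : ∀ k g → sumFin k g ≡ ∑ k g
  sumFin≡∑ k g = trans (cong sum (map-tabulate id g)) (sum-tabulate k g)
    where
    sum-tabulate : ∀ k (g : Fin k → ℕ) → sum (tabulate g) ≡ ∑ k g
    sum-tabulate zero g = refl
    sum-tabulate (suc k) g = cong (g zero +_) (sum-tabulate k (g ∘ suc))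

  sumExcept≡∑ : ∀ k j g → sumExcept k j g ≡ ∑ k (except j g)
  sumExcept≡∑ k j g = sumFin≡∑ k (except j g)

  ∑-cong : ∀ k {g h : Fin k → ℕ} → (∀ i → g i ≡ h i) → ∑ k g ≡ ∑ k h
  ∑-cong zero e = refl
  ∑-cong (suc k) e = cong₂ _+_ (e zero) (∑-cong k (e ∘ suc))

  ∑-mono-≤ : ∀ k {g h : Fin k → ℕ} → (∀ i → g i ≤ h i) → ∑ k g ≤ ∑ k h
  ∑-mono-≤ zero le = z≤n
  ∑-mono-≤ (suc k) le = +-mono-≤ (le zero) (∑-mono-≤ k (le ∘ suc))

  ∑-distrib-+ : ∀ k (g h : Fin k → ℕ) → ∑ k (λ i → g i + h i) ≡ ∑ k g + ∑ k h
  ∑-distrib-+ zero g h = refl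
  ∑-distrib-+ (suc k) g h = trans (cong (g zero + h zero +_) (∑-distrib-+ k (g ∘ suc) (h ∘ suc)))
    (+-+-interchange (g zero) (h zero) _ _)
    where
    +-+-interchange : ∀ a b c d → a + b + (c + d) ≡ a + c + (b + d)
    +-+-interchange = solve-∀

  ∑-distribˡ-* : ∀ k c (g : Fin k → ℕ) → ∑ k (λ i → c * g i) ≡ c * ∑ k g
  ∑-distribˡ-* zero c g = sym (*-zeroʳ c)
  ∑-distribˡ-* (suc k) c g = trans (cong (c * g zero +_) (∑-distribˡ-* k c (g ∘ suc)))
    (sym (*-distribˡ-+ c (g zero) _))

  ∑-const : ∀ k c → ∑ k (λ _ → c) ≡ k * c
  ∑-const zero c = refl
  ∑-const (suc k) c = cong (c +_) (∑-const k c)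

  ∑-split : ∀ k (g : Fin k → ℕ) j → ∑ k g ≡ g j + ∑ k (except j g)
  ∑-split (suc k) g zero = refl
  ∑-split (suc k) g (suc j) = begin
    g zero + ∑ k (g ∘ suc)                              ≡⟨ cong (g zero +_) (∑-split k (g ∘ suc) j) ⟩
    g zero + (g (suc j) + ∑ k (except j (g ∘ suc)))     ≡⟨ +-comm-assoc (g zero) (g (suc j)) _ ⟩
    g (suc j) + (g zero + ∑ k (except j (g ∘ suc)))     ∎
    where
    open ≡-Reasoning
    +-comm-assoc : ∀ a b c → a + (b + c) ≡ b + (a + c)
    +-comm-assoc = solve-∀

  except-other : ∀ {k} {j i : Fin k} g → i ≢ j → except j g i ≡ g i
  except-other g i≢j rewrite ≢⇒==-false i≢j = refl

  except-pointwise : ∀ {k} (R : ℕ → ℕ → Set) → R 0 0 → {j : Fin k} {g h : Fin k → ℕ}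
    → (∀ i → i ≢ j → R (g i) (h i)) → ∀ i → R (except j g i) (except j h i)
  except-pointwise R r00 {j} rel i with i ≟ j
  ... | yes _ = r00
  ... | no i≢j = rel i i≢j

  ∑-term-≤ : ∀ k (g : Fin k → ℕ) j → g j ≤ ∑ k g
  ∑-term-≤ k g j = subst (g j ≤_) (sym (∑-split k g j)) (m≤m+n (g j) _)

  ∑-except-cong : ∀ k (j : Fin k) {g h : Fin k → ℕ} → (∀ i → i ≢ j → g i ≡ h i)
    → ∑ k (except j g) ≡ ∑ k (except j h)
  ∑-except-cong k j e = ∑-cong k (except-pointwise _≡_ refl e)

  ∑-except-mono-≤ : ∀ k (j : Fin k) {g h : Fin k → ℕ} → (∀ i → i ≢ j → g i ≤ h i)
    → ∑ k (except j g) ≤ ∑ k (except j h)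
  ∑-except-mono-≤ k j le = ∑-mono-≤ k (except-pointwise _≤_ z≤n le)

  ∑-bump : ∀ k {g h : Fin k → ℕ} l e → (∀ i → h i ≤ g i) → h l + e ≤ g l → ∑ k h + e ≤ ∑ k g
  ∑-bump k {g} {h} l e le lel = begin
    ∑ k h + e                        ≡⟨ cong (_+ e) (∑-split k h l) ⟩
    h l + ∑ k (except l h) + e       ≡⟨ +-shuffle (h l) _ e ⟩
    h l + e + ∑ k (except l h)       ≤⟨ +-mono-≤ lel (∑-except-mono-≤ k l (λ i _ → le i)) ⟩
    g l + ∑ k (except l g)           ≡⟨ ∑-split k g l ⟨
    ∑ k g                            ∎
    where
    open ≤-Reasoning
    +-shuffle : ∀ a b c → a + b + c ≡ a + c + b
    +-shuffle = solve-∀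

  ∑-mono-< : ∀ k {g h : Fin k → ℕ} j → (∀ i → g i ≤ h i) → g j < h j → ∑ k g < ∑ k h
  ∑-mono-< k {g} {h} j le lt =
    subst (_≤ ∑ k h) (+-comm (∑ k g) 1) (∑-bump k j 1 le (subst (_≤ h j) (+-comm 1 (g j)) lt))

  ∑-point : ∀ k (g : Fin k → ℕ) j → (∀ i → i ≢ j → g i ≡ 0) → ∑ k g ≡ g j
  ∑-point k g j vanish = begin
    ∑ k g                      ≡⟨ ∑-split k g j ⟩
    g j + ∑ k (except j g)     ≡⟨ cong (g j +_) (∑-cong k vanish′) ⟩
    g j + ∑ k (λ _ → 0)        ≡⟨ cong (g j +_) (trans (∑-const k 0) (*-zeroʳ k)) ⟩
    g j + 0                    ≡⟨ +-identityʳ (g j) ⟩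
    g j                        ∎
    where
    open ≡-Reasoning
    vanish′ : ∀ i → except j g i ≡ 0
    vanish′ i with i ≟ j
    ... | yes _ = refl
    ... | no i≢j = vanish i i≢j

  ∑-except-const : ∀ k (j : Fin k) c → ∑ k (except j (λ _ → c)) ≡ (k ∸ 1) * c
  ∑-except-const (suc k) j c = +-cancelˡ-≡ c _ _ (trans (sym (∑-split (suc k) (λ _ → c) j)) (∑-const (suc k) c))

  ∑-except-mono-< : ∀ k (j : Fin k) {g h : Fin k → ℕ} l → l ≢ j → (∀ i → i ≢ j → g i ≤ h i) → g l < h l
    → ∑ k (except j g) < ∑ k (except j h)
  ∑-except-mono-< k j {g} {h} l l≢j le lt =
    ∑-mono-< k l (except-pointwise _≤_ z≤n le) (subst₂ _<_ (sym (except-other g l≢j)) (sym (except-other h l≢j)) lt)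

  ∑-except-distrib-+ : ∀ k (j : Fin k) (g h : Fin k → ℕ)
    → ∑ k (except j (λ i → g i + h i)) ≡ ∑ k (except j g) + ∑ k (except j h)
  ∑-except-distrib-+ k j g h = trans (∑-cong k pointwise) (∑-distrib-+ k (except j g) (except j h))
    where
    pointwise : ∀ i → except j (λ i → g i + h i) i ≡ except j g i + except j h i
    pointwise i with i == j
    ... | true = refl
    ... | false = refl

  ∑-except-distribˡ-* : ∀ k (j : Fin k) c (g : Fin k → ℕ) → ∑ k (except j (λ i → c * g i)) ≡ c * ∑ k (except j g)
  ∑-except-distribˡ-* k j c g = trans (∑-cong k pointwise) (∑-distribˡ-* k c (except j g))
    where
    pointwise : ∀ i → except j (λ i → c * g i) i ≡ c * except j g i
    pointwise i with i == j
    ... | true = sym (*-zeroʳ c)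
    ... | false = refl

  listSum : ∀ {A : Set} → (A → ℕ) → List A → ℕ
  listSum F [] = 0
  listSum F (x ∷ xs) = F x + listSum F xs

  listSum-++ : ∀ {A : Set} (F : A → ℕ) xs ys → listSum F (xs ++ ys) ≡ listSum F xs + listSum F ys
  listSum-++ F [] ys = refl
  listSum-++ F (x ∷ xs) ys = trans (cong (F x +_) (listSum-++ F xs ys)) (sym (+-assoc (F x) _ _))

  listSum-concatMap : ∀ {A B : Set} (F : B → ℕ) (f : A → List B) xs
    → listSum F (concatMap f xs) ≡ listSum (λ x → listSum F (f x)) xs
  listSum-concatMap F f [] = refl
  listSum-concatMap F f (x ∷ xs) =
    trans (listSum-++ F (f x) (concatMap f xs)) (cong (listSum F (f x) +_) (listSum-concatMap F f xs))

  listSum-map : ∀ {A B : Set} (F : B → ℕ) (h : A → B) xs → listSum F (map h xs) ≡ listSum (F ∘ h) xs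
  listSum-map F h [] = refl
  listSum-map F h (x ∷ xs) = cong (F (h x) +_) (listSum-map F h xs)

  listSum-allFin : ∀ k (F : Fin k → ℕ) → listSum F (allFin k) ≡ ∑ k F
  listSum-allFin k F = go k id
    where
    go : ∀ m (h : Fin m → Fin k) → listSum F (tabulate h) ≡ ∑ m (F ∘ h)
    go zero h = refl
    go (suc m) h = cong (F (h zero) +_) (go m (h ∘ suc))

  listSum-cong : ∀ {A : Set} {F H : A → ℕ} xs → (∀ x → F x ≡ H x) → listSum F xs ≡ listSum H xs
  listSum-cong [] e = refl
  listSum-cong (x ∷ xs) e = cong₂ _+_ (e x) (listSum-cong xs e)

  listSum-distrib-+ : ∀ {A : Set} (F H : A → ℕ) xs → listSum (λ x → F x + H x) xs ≡ listSum F xs + listSum H xs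
  listSum-distrib-+ F H [] = refl
  listSum-distrib-+ F H (x ∷ xs) = trans (cong (F x + H x +_) (listSum-distrib-+ F H xs))
    (+-+-interchange (F x) (H x) _ _)
    where
    +-+-interchange : ∀ a b c d → a + b + (c + d) ≡ a + c + (b + d)
    +-+-interchange = solve-∀

  listSum-zero : ∀ {A : Set} (xs : List A) → listSum (λ _ → 0) xs ≡ 0
  listSum-zero [] = refl
  listSum-zero (x ∷ xs) = listSum-zero xs

  listSum-comm : ∀ {A B : Set} (F : A → B → ℕ) xs ys
    → listSum (λ u → listSum (F u) ys) xs ≡ listSum (λ w → listSum (λ u → F u w) xs) ys
  listSum-comm F [] ys = sym (listSum-zero ys)
  listSum-comm F (x ∷ xs) ys = trans (cong (listSum (F x) ys +_) (listSum-comm F xs ys))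
    (sym (listSum-distrib-+ (F x) (λ w → listSum (λ u → F u w) xs) ys))

  length-filter≡listSum : ∀ {A : Set} (b : A → Bool) xs
    → length (filter (λ x → b x Bool.≟ true) xs) ≡ listSum (λ x → ⟦ b x ⟧) xs
  length-filter≡listSum b [] = refl
  length-filter≡listSum b (x ∷ xs) with b x
  ... | true = cong suc (length-filter≡listSum b xs)
  ... | false = length-filter≡listSum b xs

  module _ {k : ℕ} {n : Fin k → ℕ} where

    listSum-allV : ∀ (F : Vtx k n → ℕ) → listSum F (allV k n) ≡ ∑ k (λ i → ∑ (n i) (λ a → F (i , a)))
    listSum-allV F = trans (listSum-concatMap F _ (allFin k))
      (trans (listSum-cong (allFin k) (λ i → trans (listSum-map F (i ,_) (allFin (n i))) (listSum-allFin (n i) _)))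
        (listSum-allFin k _))

    pairSum : (Vtx k n → Vtx k n → ℕ) → ℕ
    pairSum F = listSum (λ u → listSum (F u) (allV k n)) (allV k n)

    pairSum-cong : ∀ {F H : Vtx k n → Vtx k n → ℕ} → (∀ u w → F u w ≡ H u w) → pairSum F ≡ pairSum H
    pairSum-cong e = listSum-cong (allV k n) (λ u → listSum-cong (allV k n) (e u))

    pairSum-distrib-+ : ∀ (F H : Vtx k n → Vtx k n → ℕ) → pairSum (λ u w → F u w + H u w) ≡ pairSum F + pairSum H
    pairSum-distrib-+ F H =
      trans (listSum-cong (allV k n) (λ u → listSum-distrib-+ (F u) (H u) (allV k n))) (listSum-distrib-+ _ _ (allV k n))

    pairSum-swap : ∀ (F : Vtx k n → Vtx k n → ℕ) → pairSum F ≡ pairSum (λ u w → F w u)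
    pairSum-swap F = listSum-comm F (allV k n) (allV k n)

    edges≡pairSum : (G : Graph k n) → edges G ≡ pairSum (λ u w → ⟦ (u <V w) ∧ G u w ⟧)
    edges≡pairSum G = trans (length-filter≡listSum _ pairs)
      (trans (listSum-concatMap _ (λ u → map (u ,_) (allV k n)) (allV k n))
        (listSum-cong (allV k n) (λ u → listSum-map _ (u ,_) (allV k n))))
      where
      pairs = concatMap (λ u → map (u ,_) (allV k n)) (allV k n)

    arcs : Graph k n → ℕ
    arcs G = pairSum (λ u w → ⟦ G u w ⟧)

    edges-cong : ∀ {G H : Graph k n} → G ≈G H → edges G ≡ edges H
    edges-cong {G} {H} e = trans (edges≡pairSum G)
      (trans (pairSum-cong (λ u w → cong (λ b → ⟦ (u <V w) ∧ b ⟧) (e u w))) (sym (edges≡pairSum H)))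

  <ᵇ-true : ∀ x y → x < y → (x <ᵇ y) ≡ true
  <ᵇ-true zero (suc y) _ = refl
  <ᵇ-true (suc x) (suc y) (s≤s x<y) = <ᵇ-true x y x<y

  <ᵇ-false : ∀ x y → y ≤ x → (x <ᵇ y) ≡ false
  <ᵇ-false x zero _ = refl
  <ᵇ-false (suc x) (suc y) (s≤s y≤x) = <ᵇ-false x y y≤x

  ≡ᵇ-false : ∀ x y → x ≢ y → (x ≡ᵇ y) ≡ false
  ≡ᵇ-false zero zero x≢y = ⊥-elim (x≢y refl)
  ≡ᵇ-false zero (suc y) _ = refl
  ≡ᵇ-false (suc x) zero _ = refl
  ≡ᵇ-false (suc x) (suc y) x≢y = ≡ᵇ-false x y (x≢y ∘ cong suc)

  ≡ᵇ-refl : ∀ x → (x ≡ᵇ x) ≡ true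
  ≡ᵇ-refl zero = refl
  ≡ᵇ-refl (suc x) = ≡ᵇ-refl x

  <V-exactly-one : ∀ {k} {n : Fin k → ℕ} (u w : Vtx k n) → u ≢ w → ⟦ u <V w ⟧ + ⟦ w <V u ⟧ ≡ 1
  <V-exactly-one (i , a) (j , b) u≢w with <-cmp (toℕ i) (toℕ j)
  ... | tri< i<j _ _
    rewrite <ᵇ-true _ _ i<j | <ᵇ-false (toℕ j) (toℕ i) (<⇒≤ i<j) | ≡ᵇ-false (toℕ j) (toℕ i) (>⇒≢ i<j) = refl
  ... | tri> _ i≢j j<i
    rewrite <ᵇ-true _ _ j<i | <ᵇ-false (toℕ i) (toℕ j) (<⇒≤ j<i) | ≡ᵇ-false (toℕ i) (toℕ j) i≢j
    with (toℕ j ≡ᵇ toℕ i) ∧ (toℕ b <ᵇ toℕ a)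
  ...   | true = refl
  ...   | false = refl
  <V-exactly-one (i , a) (j , b) u≢w | tri≈ _ i≡j _ with toℕ-injective i≡j
  ... | refl rewrite <ᵇ-false (toℕ i) (toℕ i) ≤-refl | ≡ᵇ-refl (toℕ i) with <-cmp (toℕ a) (toℕ b)
  ...   | tri< a<b _ _ rewrite <ᵇ-true _ _ a<b | <ᵇ-false (toℕ b) (toℕ a) (<⇒≤ a<b) = refl
  ...   | tri> _ _ b<a rewrite <ᵇ-true _ _ b<a | <ᵇ-false (toℕ a) (toℕ b) (<⇒≤ b<a) = refl
  ...   | tri≈ _ a≡b _ = ⊥-elim (u≢w (cong (i ,_) (toℕ-injective a≡b)))

  Symmetric : ∀ {k n} → Graph k n → Set
  Symmetric G = ∀ u w → G u w ≡ G w u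

  Irreflexive : ∀ {k n} → Graph k n → Set
  Irreflexive G = ∀ u → G u u ≡ false

  edges+edges≡arcs : ∀ {k} {n : Fin k → ℕ} (G : Graph k n) → Symmetric G → Irreflexive G → edges G + edges G ≡ arcs G
  edges+edges≡arcs {k} {n} G sym-G irr-G = begin
    edges G + edges G                            ≡⟨ cong₂ _+_ (edges≡pairSum G) (edges≡pairSum G) ⟩
    pairSum forward + pairSum forward            ≡⟨ cong (pairSum forward +_) (pairSum-cong (λ u w → cong (λ b → ⟦ (u <V w) ∧ b ⟧) (sym-G u w))) ⟩
    pairSum forward + pairSum (λ u w → backward w u) ≡⟨ cong (pairSum forward +_) (pairSum-swap backward) ⟨
    pairSum forward + pairSum backward           ≡⟨ pairSum-distrib-+ forward backward ⟨
    pairSum (λ u w → forward u w + backward u w) ≡⟨ pairSum-cong one-direction ⟨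
    arcs G                                       ∎
    where
    open ≡-Reasoning
    forward backward : Vtx k n → Vtx k n → ℕ
    forward u w = ⟦ (u <V w) ∧ G u w ⟧
    backward u w = ⟦ (w <V u) ∧ G u w ⟧
    one-direction : ∀ u w → ⟦ G u w ⟧ ≡ forward u w + backward u w
    one-direction u w with u ≟V w
    ... | yes refl rewrite irr-G u | ∧-zeroʳ (u <V u) = refl
    ... | no u≢w with G u w
    ...   | false rewrite ∧-zeroʳ (u <V w) | ∧-zeroʳ (w <V u) = refl
    ...   | true rewrite ∧-identityʳ (u <V w) | ∧-identityʳ (w <V u) = sym (<V-exactly-one u w u≢w)

  module _ {k : ℕ} {n : Fin k → ℕ} (D : SplitDec k n) where

    reconstruct-within : ∀ i a b → reconstruct D (i , a) (i , b) ≡ leafAdj (Q D i) a b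
    reconstruct-within i a b with i ≟ i
    ... | yes refl = refl
    ... | no i≢i = ⊥-elim (i≢i refl)

    reconstruct-across : ∀ {i l} → i ≢ l → ∀ a b
      → reconstruct D (i , a) (l , b) ≡ (splitAdj (Q D i) a ∧ q0Adj (Q0 D) i l ∧ splitAdj (Q D l) b)
    reconstruct-across {i} {l} i≢l a b with i ≟ l
    ... | yes i≡l = ⊥-elim (i≢l i≡l)
    ... | no _ = refl

  q0Adj-irrefl : ∀ {k} (q : Q0Type k) i → q0Adj q i i ≡ false
  q0Adj-irrefl complete i rewrite ==-refl i = refl
  q0Adj-irrefl (starTowards j) i rewrite ==-refl i = refl

  q0Adj-sym : ∀ {k} (q : Q0Type k) i l → q0Adj q i l ≡ q0Adj q l i
  q0Adj-sym complete i l rewrite ==-sym i l = refl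
  q0Adj-sym (starTowards j) i l rewrite ==-sym i l | ∨-comm (i == j) (l == j) = refl

  leafAdj-irrefl : ∀ {m} (q : QiType m) a → leafAdj q a a ≡ false
  leafAdj-irrefl complete a rewrite ==-refl a = refl
  leafAdj-irrefl starCenter a = refl
  leafAdj-irrefl (starSpoke c) a rewrite ==-refl a = refl

  leafAdj-sym : ∀ {m} (q : QiType m) a b → leafAdj q a b ≡ leafAdj q b a
  leafAdj-sym complete a b rewrite ==-sym a b = refl
  leafAdj-sym starCenter a b = refl
  leafAdj-sym (starSpoke c) a b rewrite ==-sym a b | ∨-comm (a == c) (b == c) = refl

  reconstruct-irrefl : ∀ {k n} (D : SplitDec k n) → Irreflexive (reconstruct D)
  reconstruct-irrefl D (i , a) = trans (reconstruct-within D i a a) (leafAdj-irrefl (Q D i) a)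

  ∧-reverse₃ : ∀ x y z → (x ∧ y ∧ z) ≡ (z ∧ y ∧ x)
  ∧-reverse₃ true true z = sym (∧-identityʳ z)
  ∧-reverse₃ true false z = sym (∧-zeroʳ z)
  ∧-reverse₃ false true z = sym (∧-zeroʳ z)
  ∧-reverse₃ false false z = sym (∧-zeroʳ z)

  reconstruct-sym : ∀ {k n} (D : SplitDec k n) → Symmetric (reconstruct D)
  reconstruct-sym D (i , a) (l , b) = by-cases (i ≟ l)
    where
    by-cases : Dec (i ≡ l) → reconstruct D (i , a) (l , b) ≡ reconstruct D (l , b) (i , a)
    by-cases (yes refl) = trans (reconstruct-within D i a b)
      (trans (leafAdj-sym (Q D i) a b) (sym (reconstruct-within D i b a)))
    by-cases (no i≢l) = begin
      reconstruct D (i , a) (l , b)                              ≡⟨ reconstruct-across D i≢l a b ⟩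
      splitAdj (Q D i) a ∧ q0Adj (Q0 D) i l ∧ splitAdj (Q D l) b ≡⟨ ∧-reverse₃ (splitAdj (Q D i) a) _ (splitAdj (Q D l) b) ⟩
      splitAdj (Q D l) b ∧ q0Adj (Q0 D) i l ∧ splitAdj (Q D i) a ≡⟨ cong (λ x → splitAdj (Q D l) b ∧ x ∧ _) (q0Adj-sym (Q0 D) i l) ⟩
      splitAdj (Q D l) b ∧ q0Adj (Q0 D) l i ∧ splitAdj (Q D i) a ≡⟨ reconstruct-across D (i≢l ∘ sym) b a ⟨
      reconstruct D (l , b) (i , a)                              ∎
      where open ≡-Reasoning

  splitDeg : ∀ {m} → QiType m → ℕ
  splitDeg {m} complete = m
  splitDeg {m} starCenter = m
  splitDeg (starSpoke c) = 1

  innerArcs : ∀ {m} → QiType m → ℕ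
  innerArcs {m} complete = m * (m ∸ 1)
  innerArcs starCenter = 0
  innerArcs {m} (starSpoke c) = (m ∸ 1) + (m ∸ 1)

  ∑-ones : ∀ m → ∑ m (λ _ → 1) ≡ m
  ∑-ones m = trans (∑-const m 1) (*-identityʳ m)

  ∑-==-point : ∀ m (c : Fin m) → ∑ m (λ b → ⟦ b == c ⟧) ≡ 1
  ∑-==-point m c = trans (∑-point m _ c (λ b b≢c → cong ⟦_⟧ (≢⇒==-false b≢c))) (cong ⟦_⟧ (==-refl c))

  ∑-≢ : ∀ m (a : Fin m) → ∑ m (λ b → ⟦ not (a == b) ⟧) ≡ m ∸ 1
  ∑-≢ m a = trans (∑-cong m pointwise) (trans (∑-except-const m a 1) (*-identityʳ (m ∸ 1)))
    where
    pointwise : ∀ b → ⟦ not (a == b) ⟧ ≡ except a (λ _ → 1) b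
    pointwise b with b ≟ a
    ... | yes refl rewrite ==-refl b = refl
    ... | no b≢a rewrite ≢⇒==-false (b≢a ∘ sym) = refl

  ∑-splitAdj : ∀ {m} (q : QiType m) → ∑ m (λ a → ⟦ splitAdj q a ⟧) ≡ splitDeg q
  ∑-splitAdj {m} complete = ∑-ones m
  ∑-splitAdj {m} starCenter = ∑-ones m
  ∑-splitAdj {m} (starSpoke c) = ∑-==-point m c

  ∑-leafAdj : ∀ {m} (q : QiType m) → ∑ m (λ a → ∑ m (λ b → ⟦ leafAdj q a b ⟧)) ≡ innerArcs q
  ∑-leafAdj {m} complete = trans (∑-cong m (∑-≢ m)) (∑-const m (m ∸ 1))
  ∑-leafAdj {m} starCenter = trans (∑-cong m (λ _ → trans (∑-const m 0) (*-zeroʳ m))) (trans (∑-const m 0) (*-zeroʳ m))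
  ∑-leafAdj {m} (starSpoke c) = trans (∑-split m _ c) (cong₂ _+_ center-row other-rows)
    where
    center-row : ∑ m (λ b → ⟦ leafAdj (starSpoke c) c b ⟧) ≡ m ∸ 1
    center-row = trans (∑-cong m (λ b → cong (λ x → ⟦ not (c == b) ∧ (x ∨ b == c) ⟧) (==-refl c)))
      (trans (∑-cong m (λ b → cong ⟦_⟧ (∧-identityʳ (not (c == b))))) (∑-≢ m c))
    leaf-row : ∀ a → a ≢ c → ∑ m (λ b → ⟦ leafAdj (starSpoke c) a b ⟧) ≡ 1
    leaf-row a a≢c = trans (∑-cong m pointwise) (∑-==-point m c)
      where
      pointwise : ∀ b → ⟦ leafAdj (starSpoke c) a b ⟧ ≡ ⟦ b == c ⟧
      pointwise b rewrite ≢⇒==-false a≢c with b ≟ c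
      ... | yes refl rewrite ≢⇒==-false a≢c = refl
      ... | no _ = cong ⟦_⟧ (∧-zeroʳ _)
    other-rows : ∑ m (except c (λ a → ∑ m (λ b → ⟦ leafAdj (starSpoke c) a b ⟧))) ≡ m ∸ 1
    other-rows = trans (∑-except-cong m c leaf-row) (trans (∑-except-const m c 1) (*-identityʳ (m ∸ 1)))

  -- The number of vertices outside V_i adjacent to a leaf-node of Q_i that sees s_i.
  reach : ∀ {k n} → SplitDec k n → Fin k → ℕ
  reach {k} D i = ∑ k (λ l → ⟦ q0Adj (Q0 D) i l ⟧ * splitDeg (Q D l))

  arcs-reconstruct : ∀ {k n} (D : SplitDec k n)
    → arcs (reconstruct D) ≡ ∑ k (λ i → innerArcs (Q D i) + splitDeg (Q D i) * reach D i)
  arcs-reconstruct {k} {n} D =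
    trans (listSum-allV {k} {n} _) (∑-cong k λ i → trans (∑-cong (n i) (λ a → listSum-allV {k} {n} _)) (part i))
    where
    row : ∀ i a → ∑ k (λ l → ∑ (n l) (λ b → ⟦ reconstruct D (i , a) (l , b) ⟧))
      ≡ ∑ (n i) (λ b → ⟦ leafAdj (Q D i) a b ⟧) + ⟦ splitAdj (Q D i) a ⟧ * reach D i
    row i a = begin
      ∑ k V                        ≡⟨ ∑-split k V i ⟩
      V i + ∑ k (except i V)       ≡⟨ cong₂ _+_ (∑-cong (n i) (λ b → cong ⟦_⟧ (reconstruct-within D i a b))) (∑-cong k across) ⟩
      ∑ (n i) (λ b → ⟦ leafAdj (Q D i) a b ⟧) + ∑ k (λ l → s * (⟦ q0Adj (Q0 D) i l ⟧ * splitDeg (Q D l)))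
                                   ≡⟨ cong (_ +_) (∑-distribˡ-* k s _) ⟩
      ∑ (n i) (λ b → ⟦ leafAdj (Q D i) a b ⟧) + s * reach D i ∎
      where
      open ≡-Reasoning
      s = ⟦ splitAdj (Q D i) a ⟧
      V : Fin k → ℕ
      V l = ∑ (n l) (λ b → ⟦ reconstruct D (i , a) (l , b) ⟧)
      across : ∀ l → except i V l ≡ s * (⟦ q0Adj (Q0 D) i l ⟧ * splitDeg (Q D l))
      across l with l ≟ i
      ... | yes refl rewrite q0Adj-irrefl (Q0 D) l = sym (*-zeroʳ s)
      ... | no l≢i = begin
        ∑ (n l) (λ b → ⟦ reconstruct D (i , a) (l , b) ⟧)
          ≡⟨ ∑-cong (n l) (λ b → trans (cong ⟦_⟧ (reconstruct-across D (l≢i ∘ sym) a b))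
               (trans (⟦∧⟧ (splitAdj (Q D i) a) _) (cong (s *_) (⟦∧⟧ (q0Adj (Q0 D) i l) _)))) ⟩
        ∑ (n l) (λ b → s * (⟦ q0Adj (Q0 D) i l ⟧ * ⟦ splitAdj (Q D l) b ⟧))
          ≡⟨ ∑-distribˡ-* (n l) s _ ⟩
        s * ∑ (n l) (λ b → ⟦ q0Adj (Q0 D) i l ⟧ * ⟦ splitAdj (Q D l) b ⟧)
          ≡⟨ cong (s *_) (trans (∑-distribˡ-* (n l) ⟦ q0Adj (Q0 D) i l ⟧ _) (cong (⟦ q0Adj (Q0 D) i l ⟧ *_) (∑-splitAdj (Q D l)))) ⟩
        s * (⟦ q0Adj (Q0 D) i l ⟧ * splitDeg (Q D l)) ∎
    part : ∀ i → ∑ (n i) (λ a → ∑ k (λ l → ∑ (n l) (λ b → ⟦ reconstruct D (i , a) (l , b) ⟧)))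
      ≡ innerArcs (Q D i) + splitDeg (Q D i) * reach D i
    part i = begin
      ∑ (n i) (λ a → ∑ k (λ l → ∑ (n l) (λ b → ⟦ reconstruct D (i , a) (l , b) ⟧)))
        ≡⟨ trans (∑-cong (n i) (row i)) (∑-distrib-+ (n i) _ _) ⟩
      ∑ (n i) (λ a → ∑ (n i) (λ b → ⟦ leafAdj (Q D i) a b ⟧)) + ∑ (n i) (λ a → ⟦ splitAdj (Q D i) a ⟧ * reach D i)
        ≡⟨ cong₂ _+_ (∑-leafAdj (Q D i)) (trans (∑-cong (n i) (λ a → *-comm ⟦ splitAdj (Q D i) a ⟧ (reach D i))) (∑-distribˡ-* (n i) (reach D i) _)) ⟩
      innerArcs (Q D i) + reach D i * ∑ (n i) (λ a → ⟦ splitAdj (Q D i) a ⟧)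
        ≡⟨ cong (innerArcs (Q D i) +_) (trans (*-comm (reach D i) _) (cong (_* reach D i) (∑-splitAdj (Q D i)))) ⟩
      innerArcs (Q D i) + splitDeg (Q D i) * reach D i ∎
      where open ≡-Reasoning

  edges+edges≡arcs-reconstruct : ∀ {k n} (G : Graph k n) (D : SplitDec k n) → HasSplitDec G D
    → edges G + edges G ≡ arcs (reconstruct D)
  edges+edges≡arcs-reconstruct G D G≈D = trans (cong₂ _+_ (edges-cong G≈D) (edges-cong G≈D))
    (edges+edges≡arcs (reconstruct D) (reconstruct-sym D) (reconstruct-irrefl D))

  -- Local complementation of split decompositions

  lcQ0 : ∀ {k} → Fin k → Q0Type k → Q0Type k
  lcQ0 i complete = starTowards i
  lcQ0 i (starTowards j) = if j == i then complete else starTowards j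

  lcQ0-center : ∀ {k} (i : Fin k) → lcQ0 i (starTowards i) ≡ complete
  lcQ0-center i = cong (λ b → if b then complete else starTowards i) (==-refl i)

  lcQ0-leaf : ∀ {k} {i j : Fin k} → i ≢ j → lcQ0 i (starTowards j) ≡ starTowards j
  lcQ0-leaf {j = j} i≢j = cong (λ b → if b then complete else starTowards j) (≢⇒==-false (i≢j ∘ sym))

  lcLeaf : ∀ {m} → Fin m → QiType m → QiType m
  lcLeaf a complete = starSpoke a
  lcLeaf a starCenter = starCenter
  lcLeaf a (starSpoke c) = if c == a then complete else starSpoke c

  lcSplit : ∀ {m} → QiType m → QiType m
  lcSplit complete = starCenter
  lcSplit starCenter = complete
  lcSplit (starSpoke c) = starSpoke c

  -- Complementing the neighbourhood of a ∈ V_i complements it inside Q_i; when a sees s_i it also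
  -- complements Q_0 at t_i and every Q_l with t_l adjacent to t_i at its split-node s_l.
  lcSplitDec : ∀ {k n} → Vtx k n → SplitDec k n → SplitDec k n
  lcSplitDec {k} {n} (i , a) D =
    splitDec (if splitAdj (Q D i) a then lcQ0 i (Q0 D) else Q0 D) (λ l → updated l (l ≟ i))
    where
    updated : (l : Fin k) → Dec (l ≡ i) → QiType (n l)
    updated l (yes refl) = lcLeaf a (Q D i)
    updated l (no _) = if splitAdj (Q D i) a ∧ q0Adj (Q0 D) i l then lcSplit (Q D l) else Q D l

  module _ {k : ℕ} {n : Fin k → ℕ} (D : SplitDec k n) (i : Fin k) (a : Fin (n i)) where

    Q-lcSplitDec-self : Q (lcSplitDec (i , a) D) i ≡ lcLeaf a (Q D i)
    Q-lcSplitDec-self with i ≟ i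
    ... | yes refl = refl
    ... | no i≢i = ⊥-elim (i≢i refl)

    Q-lcSplitDec-other : ∀ l → l ≢ i
      → Q (lcSplitDec (i , a) D) l ≡ (if splitAdj (Q D i) a ∧ q0Adj (Q0 D) i l then lcSplit (Q D l) else Q D l)
    Q-lcSplitDec-other l l≢i with l ≟ i
    ... | yes l≡i = ⊥-elim (l≢i l≡i)
    ... | no _ = refl

  ≟V-same : ∀ {k} {n : Fin k → ℕ} (p : Fin k) (x y : Fin (n p)) → does (_≟V_ {k} {n} (p , x) (p , y)) ≡ (x == y)
  ≟V-same p x y with x ≟ y
  ... | yes refl = dec-true ((p , x) ≟V (p , x)) refl
  ... | no x≢y = dec-false ((p , x) ≟V (p , y)) λ { refl → x≢y refl }

  ≟V-across : ∀ {k} {n : Fin k → ℕ} {p q : Fin k} (x : Fin (n p)) (y : Fin (n q)) → p ≢ q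
    → does (_≟V_ {k} {n} (p , x) (q , y)) ≡ false
  ≟V-across {k} {n} x y p≢q = dec-false (_≟V_ {k} {n} (_ , x) (_ , y)) λ { refl → p≢q refl }

  ≟V-sym : ∀ {k} {n : Fin k → ℕ} (u w : Vtx k n) → does (u ≟V w) ≡ does (w ≟V u)
  ≟V-sym u w = does-⇔ (mk⇔ sym sym) (u ≟V w) (w ≟V u)

  splitAdj-lcSplit : ∀ {m} (q : QiType m) x → splitAdj (lcSplit q) x ≡ splitAdj q x
  splitAdj-lcSplit complete x = refl
  splitAdj-lcSplit starCenter x = refl
  splitAdj-lcSplit (starSpoke c) x = refl

  splitAdj-if-lcSplit : ∀ {m} b (q : QiType m) x → splitAdj (if b then lcSplit q else q) x ≡ splitAdj q x
  splitAdj-if-lcSplit true q x = splitAdj-lcSplit q x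
  splitAdj-if-lcSplit false q x = refl

  leafAdj-lcSplit : ∀ {m} (q : QiType m) x y → leafAdj (lcSplit q) x y
    ≡ (if not (x == y) ∧ splitAdj q x ∧ splitAdj q y then not (leafAdj q x y) else leafAdj q x y)
  leafAdj-lcSplit complete x y with x == y
  ... | true = refl
  ... | false = refl
  leafAdj-lcSplit starCenter x y with x == y
  ... | true = refl
  ... | false = refl
  leafAdj-lcSplit (starSpoke c) x y with x ≟ c | y ≟ c
  ... | yes refl | yes refl rewrite ==-refl x = refl
  ... | yes refl | no _ rewrite ∧-zeroʳ (not (x == y)) = refl
  ... | no _ | _ rewrite ∧-zeroʳ (not (x == y)) = refl

  splitAdj-lcLeaf : ∀ {m} (q : QiType m) a x → splitAdj (lcLeaf a q) x
    ≡ (if leafAdj q a x ∧ splitAdj q a then not (splitAdj q x) else splitAdj q x)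
  splitAdj-lcLeaf complete a x with x ≟ a
  ... | yes refl rewrite ==-refl x = refl
  ... | no x≢a rewrite ≢⇒==-false (x≢a ∘ sym) = refl
  splitAdj-lcLeaf starCenter a x = refl
  splitAdj-lcLeaf (starSpoke c) a x with c ≟ a
  ... | yes refl with x ≟ c
  ...   | yes refl rewrite ==-refl x = refl
  ...   | no x≢c rewrite ≢⇒==-false (x≢c ∘ sym) | ==-refl c = refl
  splitAdj-lcLeaf (starSpoke c) a x | no c≢a
    rewrite ≢⇒==-false (c≢a ∘ sym) | ∧-zeroʳ (not (a == x) ∧ (x == c)) = refl

  leafAdj-lcLeaf : ∀ {m} (q : QiType m) a x y → leafAdj (lcLeaf a q) x y
    ≡ (if not (x == y) ∧ leafAdj q a x ∧ leafAdj q a y then not (leafAdj q x y) else leafAdj q x y)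
  leafAdj-lcLeaf complete a x y rewrite ==-sym a x | ==-sym a y with x == y | x == a | y == a
  ... | true | _ | _ = refl
  ... | false | true | _ = refl
  ... | false | false | true = refl
  ... | false | false | false = refl
  leafAdj-lcLeaf starCenter a x y with not (x == y)
  ... | true = refl
  ... | false = refl
  leafAdj-lcLeaf (starSpoke c) a x y with c ≟ a
  ... | yes refl rewrite ==-refl c | ==-sym c x | ==-sym c y with x == y | x == c | y == c
  ...   | true | _ | _ = refl
  ...   | false | true | _ = refl
  ...   | false | false | true = refl
  ...   | false | false | false = refl
  leafAdj-lcLeaf (starSpoke c) a x y | no c≢a rewrite ≢⇒==-false (c≢a ∘ sym) with x ≟ c | y ≟ c
  ...   | yes refl | yes refl rewrite ==-refl x = refl
  ...   | yes refl | no y≢c rewrite ∧-zeroʳ (not (a == y)) | ∧-zeroʳ (not (a == c) ∧ true) | ∧-zeroʳ (not (c == y)) = refl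
  ...   | no x≢c | _ rewrite ∧-zeroʳ (not (a == x)) | ∧-zeroʳ (not (x == y)) = refl

  q0Adj-lcQ0-center : ∀ {k} (q : Q0Type k) i r → q0Adj (lcQ0 i q) i r ≡ q0Adj q i r
  q0Adj-lcQ0-center complete i r rewrite ==-refl i with i == r
  ... | true = refl
  ... | false = refl
  q0Adj-lcQ0-center (starTowards j) i r with j ≟ i
  ... | yes refl rewrite ==-refl j with j == r
  ...   | true = refl
  ...   | false = refl
  q0Adj-lcQ0-center (starTowards j) i r | no j≢i = refl

  q0Adj-if-lcQ0-center : ∀ {k} b (q : Q0Type k) i r → q0Adj (if b then lcQ0 i q else q) i r ≡ q0Adj q i r
  q0Adj-if-lcQ0-center true q i r = q0Adj-lcQ0-center q i r
  q0Adj-if-lcQ0-center false q i r = refl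

  q0Adj-lcQ0 : ∀ {k} (q : Q0Type k) i p r → p ≢ i → r ≢ i → q0Adj (lcQ0 i q) p r
    ≡ (if not (p == r) ∧ q0Adj q i p ∧ q0Adj q i r then not (q0Adj q p r) else q0Adj q p r)
  q0Adj-lcQ0 complete i p r p≢i r≢i
    rewrite ≢⇒==-false p≢i | ≢⇒==-false r≢i | ≢⇒==-false (p≢i ∘ sym) | ≢⇒==-false (r≢i ∘ sym) with p == r
  ... | true = refl
  ... | false = refl
  q0Adj-lcQ0 (starTowards j) i p r p≢i r≢i with j ≟ i
  ... | yes refl rewrite ≢⇒==-false p≢i | ≢⇒==-false r≢i | ≢⇒==-false (p≢i ∘ sym) | ≢⇒==-false (r≢i ∘ sym) | ==-refl j
    with p == r
  ...   | true = refl
  ...   | false = refl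
  q0Adj-lcQ0 (starTowards j) i p r p≢i r≢i | no j≢i rewrite ≢⇒==-false (j≢i ∘ sym) with p ≟ j | r ≟ j
  ...   | yes refl | yes refl rewrite ==-refl p = refl
  ...   | yes refl | no r≢j rewrite ∧-zeroʳ (not (i == r)) | ∧-zeroʳ (not (i == j) ∧ true) | ∧-zeroʳ (not (j == r)) = refl
  ...   | no p≢j | _ rewrite ∧-zeroʳ (not (i == p)) | ∧-zeroʳ (not (p == r)) = refl

  if-toggle-∧ʳ : ∀ L A X W → (if L ∧ A ∧ W then not (X ∧ W) else X ∧ W) ≡ (if L ∧ A then not X else X) ∧ W
  if-toggle-∧ʳ false A X W = refl
  if-toggle-∧ʳ true false X W = refl
  if-toggle-∧ʳ true true true true = refl
  if-toggle-∧ʳ true true true false = refl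
  if-toggle-∧ʳ true true false true = refl
  if-toggle-∧ʳ true true false false = refl

  if-toggle-∧-middle : ∀ X Y P R Z
    → (if (P ∧ X) ∧ (R ∧ Y) then not (X ∧ Z ∧ Y) else X ∧ Z ∧ Y) ≡ X ∧ (if P ∧ R then not Z else Z) ∧ Y
  if-toggle-∧-middle X Y false R Z = refl
  if-toggle-∧-middle false Y true R Z = refl
  if-toggle-∧-middle true Y true R Z = if-toggle-∧ʳ true R Z Y

  lc-sym : ∀ {k} {n : Fin k → ℕ} (v : Vtx k n) (G : Graph k n) → Symmetric G → Symmetric (lc v G)
  lc-sym v G sym-G u w rewrite ≟V-sym u w | sym-G u w with G v u | G v w
  ... | true | true = refl
  ... | true | false rewrite ∧-zeroʳ (not (does (w ≟V u))) = refl
  ... | false | true = refl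
  ... | false | false rewrite ∧-zeroʳ (not (does (w ≟V u))) = refl

  module _ {k : ℕ} {n : Fin k → ℕ} (D : SplitDec k n) (i : Fin k) (a : Fin (n i)) where
    private
      G = reconstruct D
      D′ = lcSplitDec (i , a) D

    lc-within-pivot : ∀ x y → lc (i , a) G (i , x) (i , y) ≡ reconstruct D′ (i , x) (i , y)
    lc-within-pivot x y
      rewrite ≟V-same {k} {n} i x y | reconstruct-within D i a x | reconstruct-within D i a y
            | reconstruct-within D i x y | reconstruct-within D′ i x y | Q-lcSplitDec-self D i a
      = sym (leafAdj-lcLeaf (Q D i) a x y)

    lc-from-pivot : ∀ q → i ≢ q → ∀ x y → lc (i , a) G (i , x) (q , y) ≡ reconstruct D′ (i , x) (q , y)
    lc-from-pivot q i≢q x y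
      rewrite ≟V-across {k} {n} x y i≢q | reconstruct-within D i a x | reconstruct-across D i≢q a y
            | reconstruct-across D i≢q x y | reconstruct-across D′ i≢q x y | Q-lcSplitDec-self D i a
            | Q-lcSplitDec-other D i a q (i≢q ∘ sym)
            | splitAdj-if-lcSplit (splitAdj (Q D i) a ∧ q0Adj (Q0 D) i q) (Q D q) y
            | q0Adj-if-lcQ0-center (splitAdj (Q D i) a) (Q0 D) i q | splitAdj-lcLeaf (Q D i) a x
      = if-toggle-∧ʳ (leafAdj (Q D i) a x) (splitAdj (Q D i) a) (splitAdj (Q D i) x) (q0Adj (Q0 D) i q ∧ splitAdj (Q D q) y)

    lc-within-other : ∀ p → i ≢ p → ∀ x y → lc (i , a) G (p , x) (p , y) ≡ reconstruct D′ (p , x) (p , y)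
    lc-within-other p i≢p x y
      rewrite ≟V-same {k} {n} p x y | reconstruct-across D i≢p a x | reconstruct-across D i≢p a y
            | reconstruct-within D p x y | reconstruct-within D′ p x y | Q-lcSplitDec-other D i a p (i≢p ∘ sym)
      with splitAdj (Q D i) a | q0Adj (Q0 D) i p
    ... | true | true = sym (leafAdj-lcSplit (Q D p) x y)
    ... | true | false rewrite ∧-zeroʳ (not (x == y)) = refl
    ... | false | _ rewrite ∧-zeroʳ (not (x == y)) = refl

    lc-across-others : ∀ p q → i ≢ p → i ≢ q → p ≢ q → ∀ x y → lc (i , a) G (p , x) (q , y) ≡ reconstruct D′ (p , x) (q , y)
    lc-across-others p q i≢p i≢q p≢q x y
      rewrite ≟V-across {k} {n} x y p≢q | reconstruct-across D i≢p a x | reconstruct-across D i≢q a y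
            | reconstruct-across D p≢q x y | reconstruct-across D′ p≢q x y
            | Q-lcSplitDec-other D i a p (i≢p ∘ sym) | Q-lcSplitDec-other D i a q (i≢q ∘ sym)
            | splitAdj-if-lcSplit (splitAdj (Q D i) a ∧ q0Adj (Q0 D) i p) (Q D p) x
            | splitAdj-if-lcSplit (splitAdj (Q D i) a ∧ q0Adj (Q0 D) i q) (Q D q) y
      with splitAdj (Q D i) a
    ... | false = refl
    ... | true rewrite q0Adj-lcQ0 (Q0 D) i p q (i≢p ∘ sym) (i≢q ∘ sym) | ≢⇒==-false p≢q
      = if-toggle-∧-middle (splitAdj (Q D p) x) (splitAdj (Q D q) y) (q0Adj (Q0 D) i p) (q0Adj (Q0 D) i q) (q0Adj (Q0 D) p q)

    lc-reconstruct : lc (i , a) G ≈G reconstruct D′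
    lc-reconstruct (p , x) (q , y) = by-cases (i ≟ p) (i ≟ q) (p ≟ q)
      where
      by-cases : Dec (i ≡ p) → Dec (i ≡ q) → Dec (p ≡ q) → lc (i , a) G (p , x) (q , y) ≡ reconstruct D′ (p , x) (q , y)
      by-cases (yes refl) (yes refl) _ = lc-within-pivot x y
      by-cases (yes refl) (no i≢q) _ = lc-from-pivot q i≢q x y
      by-cases (no i≢p) (yes refl) _ = trans (lc-sym (i , a) G (reconstruct-sym D) (p , x) (i , y))
        (trans (lc-from-pivot p i≢p y x) (reconstruct-sym D′ (i , y) (p , x)))
      by-cases (no i≢p) (no i≢q) (yes refl) = lc-within-other p i≢p x y
      by-cases (no i≢p) (no i≢q) (no p≢q) = lc-across-others p q i≢p i≢q p≢q x y

  -- An invariant of the orbit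

  isComplete isCenter isSpoke : ∀ {m} → QiType m → Bool
  isComplete complete = true
  isComplete starCenter = false
  isComplete (starSpoke _) = false
  isCenter complete = false
  isCenter starCenter = true
  isCenter (starSpoke _) = false
  isSpoke complete = false
  isSpoke starCenter = false
  isSpoke (starSpoke _) = true

  isSpoke-lcSplit : ∀ {m} (q : QiType m) → isSpoke (lcSplit q) ≡ isSpoke q
  isSpoke-lcSplit complete = refl
  isSpoke-lcSplit starCenter = refl
  isSpoke-lcSplit (starSpoke c) = refl

  isCenter-lcSplit : ∀ {m} (q : QiType m) → isCenter (lcSplit q) ≡ isComplete q
  isCenter-lcSplit complete = refl
  isCenter-lcSplit starCenter = refl
  isCenter-lcSplit (starSpoke c) = refl

  isComplete-lcSplit : ∀ {m} (q : QiType m) → isComplete (lcSplit q) ≡ isCenter q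
  isComplete-lcSplit complete = refl
  isComplete-lcSplit starCenter = refl
  isComplete-lcSplit (starSpoke c) = refl

  not-isComplete : ∀ {m} (q : QiType m) → isSpoke q ≡ false → not (isComplete q) ≡ isCenter q
  not-isComplete complete _ = refl
  not-isComplete starCenter _ = refl

  isEven : ℕ → Bool
  isEven zero = true
  isEven (suc m) = not (isEven m)

  isEven-step : ∀ a b x y → a + ⟦ x ⟧ ≡ b + ⟦ y ⟧ → isEven a ≡ (x Bool.xor y) Bool.xor isEven b
  isEven-step a b false false e = cong isEven (+-cancelʳ-≡ 0 a b e)
  isEven-step a b true true e = cong isEven (+-cancelʳ-≡ 1 a b e)
  isEven-step a b false true e = cong isEven (trans (sym (+-identityʳ a)) (trans e (+-comm b 1)))
  isEven-step a b true false e = trans (sym (not-involutive (isEven a)))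
    (cong (not ∘ isEven) (trans (+-comm 1 a) (trans e (+-identityʳ b))))

  module _ {k : ℕ} {n : Fin k → ℕ} where

    spokeCount : ((i : Fin k) → QiType (n i)) → ℕ
    spokeCount Q = ∑ k (λ i → ⟦ isSpoke (Q i) ⟧)

    -- Satisfied by every decomposition in the LC orbit of CS^r; the parity clause is what separates
    -- the cases k even and k odd of the theorem.
    Invariant : Q0Type k → ((i : Fin k) → QiType (n i)) → Set
    Invariant complete Q = (∀ i → isComplete (Q i) ≡ false) × (isEven (spokeCount Q) ≡ false)
    Invariant (starTowards j) Q =
      (isSpoke (Q j) ≡ false) × (∀ i → i ≢ j → isCenter (Q i) ≡ false) × (isEven (spokeCount Q) ≡ isComplete (Q j))

    OrbitInvariant : SplitDec k n → Set
    OrbitInvariant D = Invariant (Q0 D) (Q D)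

    Invariant-cong : ∀ q0 {Q Q′ : (i : Fin k) → QiType (n i)} → (∀ i → Q′ i ≡ Q i) → Invariant q0 Q → Invariant q0 Q′
    Invariant-cong complete e (noComplete , odd) =
      (λ i → trans (cong isComplete (e i)) (noComplete i)) , trans (cong isEven (∑-cong k (λ i → cong (⟦_⟧ ∘ isSpoke) (e i)))) odd
    Invariant-cong (starTowards j) e (notSpoke , noCenter , parity) =
      trans (cong isSpoke (e j)) notSpoke , (λ i i≢j → trans (cong isCenter (e i)) (noCenter i i≢j)) ,
      trans (cong isEven (∑-cong k (λ i → cong (⟦_⟧ ∘ isSpoke) (e i)))) (trans parity (sym (cong isComplete (e j))))

    spokeCount-update : ∀ (Q Q′ : (i : Fin k) → QiType (n i)) i → (∀ l → l ≢ i → isSpoke (Q′ l) ≡ isSpoke (Q l))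
      → spokeCount Q′ + ⟦ isSpoke (Q i) ⟧ ≡ spokeCount Q + ⟦ isSpoke (Q′ i) ⟧
    spokeCount-update Q Q′ i same = begin
      spokeCount Q′ + ⟦ isSpoke (Q i) ⟧                      ≡⟨ cong (_+ ⟦ isSpoke (Q i) ⟧) (∑-split k _ i) ⟩
      ⟦ isSpoke (Q′ i) ⟧ + R′ + ⟦ isSpoke (Q i) ⟧            ≡⟨ cong (λ x → ⟦ isSpoke (Q′ i) ⟧ + x + ⟦ isSpoke (Q i) ⟧) rest ⟩
      ⟦ isSpoke (Q′ i) ⟧ + R + ⟦ isSpoke (Q i) ⟧             ≡⟨ swap-ends ⟦ isSpoke (Q′ i) ⟧ R ⟦ isSpoke (Q i) ⟧ ⟩
      ⟦ isSpoke (Q i) ⟧ + R + ⟦ isSpoke (Q′ i) ⟧             ≡⟨ cong (_+ ⟦ isSpoke (Q′ i) ⟧) (∑-split k _ i) ⟨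
      spokeCount Q + ⟦ isSpoke (Q′ i) ⟧                      ∎
      where
      open ≡-Reasoning
      R R′ : ℕ
      R = ∑ k (except i (λ l → ⟦ isSpoke (Q l) ⟧))
      R′ = ∑ k (except i (λ l → ⟦ isSpoke (Q′ l) ⟧))
      rest : R′ ≡ R
      rest = ∑-except-cong k i (λ l l≢i → cong ⟦_⟧ (same l l≢i))
      swap-ends : ∀ x y z → x + y + z ≡ z + y + x
      swap-ends = solve-∀

  module LCStep {k : ℕ} {n : Fin k → ℕ} (D : SplitDec k n) (i : Fin k) (a : Fin (n i)) where
    D′ : SplitDec k n
    D′ = lcSplitDec (i , a) D

    adj : Bool
    adj = splitAdj (Q D i) a

    Q0-adj : adj ≡ true → Q0 D′ ≡ lcQ0 i (Q0 D)
    Q0-adj e = cong (λ b → if b then lcQ0 i (Q0 D) else Q0 D) e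

    Q-self : Q D′ i ≡ lcLeaf a (Q D i)
    Q-self = Q-lcSplitDec-self D i a

    Q-near : adj ≡ true → ∀ l → l ≢ i → q0Adj (Q0 D) i l ≡ true → Q D′ l ≡ lcSplit (Q D l)
    Q-near e l l≢i near rewrite Q-lcSplitDec-other D i a l l≢i | e | near = refl

    Q-untouched : ∀ l → l ≢ i → adj ∧ q0Adj (Q0 D) i l ≡ false → Q D′ l ≡ Q D l
    Q-untouched l l≢i untouched rewrite Q-lcSplitDec-other D i a l l≢i | untouched = refl

    Q-far : ∀ l → l ≢ i → q0Adj (Q0 D) i l ≡ false → Q D′ l ≡ Q D l
    Q-far l l≢i far = Q-untouched l l≢i (trans (cong (adj ∧_) far) (∧-zeroʳ adj))

    spokeParity : isEven (spokeCount (Q D′)) ≡ (isSpoke (Q D i) Bool.xor isSpoke (Q D′ i)) Bool.xor isEven (spokeCount (Q D))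
    spokeParity = isEven-step (spokeCount (Q D′)) (spokeCount (Q D)) (isSpoke (Q D i)) (isSpoke (Q D′ i))
      (spokeCount-update (Q D) (Q D′) i isSpoke-other)
      where
      isSpoke-other : ∀ l → l ≢ i → isSpoke (Q D′ l) ≡ isSpoke (Q D l)
      isSpoke-other l l≢i rewrite Q-lcSplitDec-other D i a l l≢i with adj ∧ q0Adj (Q0 D) i l
      ... | true = isSpoke-lcSplit (Q D l)
      ... | false = refl

    spokeParity-at : ∀ {q q′} → Q D i ≡ q → Q D′ i ≡ q′
      → isEven (spokeCount (Q D′)) ≡ (isSpoke q Bool.xor isSpoke q′) Bool.xor isEven (spokeCount (Q D))
    spokeParity-at refl e′ = trans spokeParity (cong (λ q′ → (isSpoke (Q D i) Bool.xor isSpoke q′) Bool.xor _) e′)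

    everywhere : (P : (l : Fin k) → QiType (n l) → Set) → P i (Q D′ i) → (∀ l → l ≢ i → P l (Q D′ l))
      → ∀ l → P l (Q D′ l)
    everywhere P at-i off-i l = by-cases (l ≟ i)
      where
      by-cases : Dec (l ≡ i) → P l (Q D′ l)
      by-cases (yes refl) = at-i
      by-cases (no l≢i) = off-i l l≢i

    unchanged : adj ≡ false → Q D′ i ≡ Q D i → OrbitInvariant D → OrbitInvariant D′
    unchanged e same inv rewrite e = Invariant-cong (Q0 D) pointwise inv
      where
      pointwise : ∀ l → Q D′ l ≡ Q D l
      pointwise = everywhere (λ l q → q ≡ Q D l) same (λ l l≢i → Q-untouched l l≢i (cong (_∧ q0Adj (Q0 D) i l) e))

  q0Adj-complete : ∀ {k} {i l : Fin k} → i ≢ l → q0Adj complete i l ≡ true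
  q0Adj-complete i≢l = cong not (≢⇒==-false i≢l)

  q0Adj-from-center : ∀ {k} {j l : Fin k} → l ≢ j → q0Adj (starTowards j) j l ≡ true
  q0Adj-from-center {j = j} l≢j rewrite ≢⇒==-false (l≢j ∘ sym) | ==-refl j = refl

  q0Adj-to-center : ∀ {k} {i j : Fin k} → i ≢ j → q0Adj (starTowards j) i j ≡ true
  q0Adj-to-center {j = j} i≢j rewrite ≢⇒==-false i≢j | ==-refl j = refl

  q0Adj-between-leaves : ∀ {k} {i j l : Fin k} → i ≢ j → l ≢ j → q0Adj (starTowards j) i l ≡ false
  q0Adj-between-leaves {i = i} {l = l} i≢j l≢j rewrite ≢⇒==-false i≢j | ≢⇒==-false l≢j = ∧-zeroʳ (not (i == l))

  lcLeaf-center : ∀ {m} (c : Fin m) → lcLeaf c (starSpoke c) ≡ complete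
  lcLeaf-center c = cong (λ b → if b then complete else starSpoke c) (==-refl c)

  lcLeaf-leaf : ∀ {m} {a c : Fin m} → a ≢ c → lcLeaf a (starSpoke c) ≡ starSpoke c
  lcLeaf-leaf {c = c} a≢c = cong (λ b → if b then complete else starSpoke c) (≢⇒==-false (a≢c ∘ sym))

  invariant-from-complete : ∀ {k} {n : Fin k → ℕ} (Qf : (i : Fin k) → QiType (n i)) v
    → Invariant complete Qf → OrbitInvariant (lcSplitDec v (splitDec complete Qf))
  invariant-from-complete {k} {n} Qf (i , a) (noComplete , odd) = by-pivot (Qf i) refl
    where
    D : SplitDec k n
    D = splitDec complete Qf
    open LCStep D i a
    becomes-star : adj ≡ true → isSpoke (Q D′ i) ≡ false → isEven (spokeCount (Q D′)) ≡ isComplete (Q D′ i)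
      → OrbitInvariant D′
    becomes-star adj≡true notSpoke par = subst (λ q → Invariant q (Q D′)) (sym (Q0-adj adj≡true)) (notSpoke , noCenter , par)
      where
      noCenter : ∀ l → l ≢ i → isCenter (Q D′ l) ≡ false
      noCenter l l≢i = trans (cong isCenter (Q-near adj≡true l l≢i (q0Adj-complete (l≢i ∘ sym))))
        (trans (isCenter-lcSplit (Qf l)) (noComplete l))
    by-pivot : (q : QiType (n i)) → Qf i ≡ q → OrbitInvariant D′
    by-pivot complete e = ⊥-elim (true≢false (trans (cong isComplete (sym e)) (noComplete i)))
    by-pivot starCenter e = becomes-star (cong (λ q → splitAdj q a) e) (cong isSpoke self)
      (trans (spokeParity-at e self)
        (trans odd (cong isComplete (sym self))))
      where
      self : Q D′ i ≡ starCenter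
      self = trans Q-self (cong (lcLeaf a) e)
    by-pivot (starSpoke c) e with a ≟ c
    ... | yes refl = becomes-star (trans (cong (λ q → splitAdj q a) e) (==-refl a)) (cong isSpoke self)
      (trans (spokeParity-at e self)
        (trans (cong not odd) (cong isComplete (sym self))))
      where
      self : Q D′ i ≡ complete
      self = trans Q-self (trans (cong (lcLeaf a) e) (lcLeaf-center a))
    ... | no a≢c = unchanged (trans (cong (λ q → splitAdj q a) e) (≢⇒==-false a≢c))
      (trans Q-self (trans (cong (lcLeaf a) e) (trans (lcLeaf-leaf a≢c) (sym e)))) (noComplete , odd)
  invariant-from-star : ∀ {k} {n : Fin k → ℕ} j (Qf : (i : Fin k) → QiType (n i)) v
    → Invariant (starTowards j) Qf → OrbitInvariant (lcSplitDec v (splitDec (starTowards j) Qf))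
  invariant-from-star {k} {n} j Qf (i , a) (notSpoke , noCenter , par) = by-cases (i ≟ j) (Qf i) refl
    where
    D : SplitDec k n
    D = splitDec (starTowards j) Qf
    open LCStep D i a
    becomes-complete : i ≡ j → adj ≡ true → isComplete (Q D′ i) ≡ false → isEven (spokeCount (Q D′)) ≡ false
      → OrbitInvariant D′
    becomes-complete refl adj≡true notComplete odd′ =
      subst (λ q → Invariant q (Q D′)) (sym (trans (Q0-adj adj≡true) (lcQ0-center i)))
        (noComplete , odd′)
      where
      noComplete : ∀ l → isComplete (Q D′ l) ≡ false
      noComplete = everywhere (λ _ q → isComplete q ≡ false) notComplete
        (λ l l≢i → trans (cong isComplete (Q-near adj≡true l l≢i (q0Adj-from-center l≢i)))
          (trans (isComplete-lcSplit (Qf l)) (noCenter l l≢i)))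
    stays-star : i ≢ j → adj ≡ true → isCenter (Q D′ i) ≡ false
      → isEven (spokeCount (Q D′)) ≡ not (isEven (spokeCount Qf)) → OrbitInvariant D′
    stays-star i≢j adj≡true notCenter par′ =
      subst (λ q → Invariant q (Q D′)) (sym (trans (Q0-adj adj≡true) (lcQ0-leaf i≢j)))
        (trans (cong isSpoke at-j) (trans (isSpoke-lcSplit (Qf j)) notSpoke) , noCenter′ ,
         trans par′ (trans (cong not par) (trans (not-isComplete (Qf j) notSpoke)
           (sym (trans (cong isComplete at-j) (isComplete-lcSplit (Qf j)))))))
      where
      at-j : Q D′ j ≡ lcSplit (Qf j)
      at-j = Q-near adj≡true j (i≢j ∘ sym) (q0Adj-to-center i≢j)
      noCenter′ : ∀ l → l ≢ j → isCenter (Q D′ l) ≡ false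
      noCenter′ = everywhere (λ l q → l ≢ j → isCenter q ≡ false) (λ _ → notCenter)
        (λ l l≢i l≢j → trans (cong isCenter (Q-far l l≢i (q0Adj-between-leaves i≢j l≢j)))
          (noCenter l l≢j))
    by-cases : Dec (i ≡ j) → (q : QiType (n i)) → Qf i ≡ q → OrbitInvariant D′
    by-cases (yes refl) (starSpoke c) e = ⊥-elim (true≢false (trans (cong isSpoke (sym e)) notSpoke))
    by-cases (yes refl) complete e = becomes-complete refl (cong (λ q → splitAdj q a) e) (cong isComplete self)
      (trans (spokeParity-at e self)
        (cong not (trans par (cong isComplete e))))
      where
      self : Q D′ i ≡ starSpoke a
      self = trans Q-self (cong (lcLeaf a) e)
    by-cases (yes refl) starCenter e = becomes-complete refl (cong (λ q → splitAdj q a) e) (cong isComplete self)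
      (trans (spokeParity-at e self)
        (trans par (cong isComplete e)))
      where
      self : Q D′ i ≡ starCenter
      self = trans Q-self (cong (lcLeaf a) e)
    by-cases (no i≢j) starCenter e = ⊥-elim (true≢false (trans (cong isCenter (sym e)) (noCenter i i≢j)))
    by-cases (no i≢j) complete e = stays-star i≢j (cong (λ q → splitAdj q a) e) (cong isCenter self)
      (spokeParity-at e self)
      where
      self : Q D′ i ≡ starSpoke a
      self = trans Q-self (cong (lcLeaf a) e)
    by-cases (no i≢j) (starSpoke c) e with a ≟ c
    ... | yes refl = stays-star i≢j (trans (cong (λ q → splitAdj q a) e) (==-refl a)) (cong isCenter self)
      (spokeParity-at e self)
      where
      self : Q D′ i ≡ complete
      self = trans Q-self (trans (cong (lcLeaf a) e) (lcLeaf-center a))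
    ... | no a≢c = unchanged (trans (cong (λ q → splitAdj q a) e) (≢⇒==-false a≢c))
      (trans Q-self (trans (cong (lcLeaf a) e) (trans (lcLeaf-leaf a≢c) (sym e)))) (notSpoke , noCenter , par)

  lcSplitDec-invariant : ∀ {k} {n : Fin k → ℕ} (D : SplitDec k n) v → OrbitInvariant D → OrbitInvariant (lcSplitDec v D)
  lcSplitDec-invariant (splitDec complete Qf) = invariant-from-complete Qf
  lcSplitDec-invariant (splitDec (starTowards j) Qf) = invariant-from-star j Qf

  lcSplitDecs : ∀ {k n} → List (Vtx k n) → SplitDec k n → SplitDec k n
  lcSplitDecs [] D = D
  lcSplitDecs (v ∷ vs) D = lcSplitDecs vs (lcSplitDec v D)

  lcSplitDecs-++ : ∀ {k n} (vs ws : List (Vtx k n)) D → lcSplitDecs (vs ++ ws) D ≡ lcSplitDecs ws (lcSplitDecs vs D)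
  lcSplitDecs-++ [] ws D = refl
  lcSplitDecs-++ (v ∷ vs) ws D = lcSplitDecs-++ vs ws (lcSplitDec v D)

  lc-cong : ∀ {k n} (v : Vtx k n) {G H : Graph k n} → G ≈G H → lc v G ≈G lc v H
  lc-cong v {G} {H} G≈H u w rewrite G≈H v u | G≈H v w | G≈H u w = refl

  lcs-reconstruct : ∀ {k n} (vs : List (Vtx k n)) (G : Graph k n) (D : SplitDec k n) → HasSplitDec G D
    → HasSplitDec (lcs vs G) (lcSplitDecs vs D)
  lcs-reconstruct [] G D G≈D = G≈D
  lcs-reconstruct (v@(i , a) ∷ vs) G D G≈D =
    lcs-reconstruct vs (lc v G) (lcSplitDec v D) (λ u w → trans (lc-cong v G≈D u w) (lc-reconstruct D i a u w))

  lcSplitDecs-invariant : ∀ {k n} (vs : List (Vtx k n)) (D : SplitDec k n) → OrbitInvariant D → OrbitInvariant (lcSplitDecs vs D)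
  lcSplitDecs-invariant [] D inv = inv
  lcSplitDecs-invariant (v ∷ vs) D inv = lcSplitDecs-invariant vs (lcSplitDec v D) (lcSplitDec-invariant D v inv)

  cliqueStarDec : ∀ {k} (n : Fin k → ℕ) → Fin k → SplitDec k n
  cliqueStarDec n r = splitDec (starTowards r) (λ _ → complete)

  cliqueStarDec-invariant : ∀ {k} (n : Fin k → ℕ) r → OrbitInvariant (cliqueStarDec n r)
  cliqueStarDec-invariant {k} n r = refl , (λ _ _ → refl) , cong isEven (trans (∑-const k 0) (*-zeroʳ k))

  CS-splitDec : ∀ {k} (n : Fin k → ℕ) r → HasSplitDec (CS k n r) (cliqueStarDec n r)
  CS-splitDec {k} n r u w with u ≟V w
  ... | yes refl = sym (reconstruct-irrefl (cliqueStarDec n r) u)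
  CS-splitDec {k} n r (p , x) (q , y) | no u≢w = by-cases (p ≟ q)
    where
    by-cases : Dec (p ≡ q) → (p == q ∨ p == r ∨ q == r) ≡ reconstruct (cliqueStarDec n r) (p , x) (q , y)
    by-cases (yes refl) rewrite reconstruct-within (cliqueStarDec n r) p x y | ==-refl p
      | ≢⇒==-false {i = x} {j = y} (u≢w ∘ cong (p ,_)) = refl
    by-cases (no p≢q) rewrite reconstruct-across (cliqueStarDec n r) p≢q x y | ≢⇒==-false p≢q = sym (∧-identityʳ _)

  orbit-splitDec : ∀ {k} {n : Fin k → ℕ} r (H : Graph k n) → H ∈Orbit CS k n r
    → Σ (SplitDec k n) (λ D → OrbitInvariant D × HasSplitDec H D)
  orbit-splitDec {k} {n} r H (vs , H≈) = lcSplitDecs vs (cliqueStarDec n r) ,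
    lcSplitDecs-invariant vs _ (cliqueStarDec-invariant n r) ,
    (λ u w → trans (H≈ u w) (lcs-reconstruct vs (CS k n r) _ (CS-splitDec n r) u w))

  lcs-∈Orbit : ∀ {k} {n : Fin k → ℕ} r (vs : List (Vtx k n)) → lcs vs (CS k n r) ∈Orbit CS k n r
  lcs-∈Orbit r vs = vs , λ u w → refl

  -- Uniqueness of split decompositions

  another : ∀ {k} → 2 ≤ k → (x : Fin k) → ∃ λ z → z ≢ x
  another {suc zero} (s≤s ()) _
  another {suc (suc k)} _ zero = suc zero , λ ()
  another {suc (suc k)} _ (suc x) = zero , λ ()

  another₂ : ∀ {k} → 3 ≤ k → (x y : Fin k) → ∃ λ z → z ≢ x × z ≢ y
  another₂ {suc zero} (s≤s ())
  another₂ {suc (suc zero)} (s≤s (s≤s ()))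
  another₂ {suc (suc (suc k))} _ = avoid
    where
    avoid : (x y : Fin (3 + k)) → ∃ λ z → z ≢ x × z ≢ y
    avoid (suc x) (suc y) = zero , (λ ()) , (λ ())
    avoid zero zero = suc zero , (λ ()) , (λ ())
    avoid zero (suc zero) = suc (suc zero) , (λ ()) , (λ ())
    avoid zero (suc (suc y)) = suc zero , (λ ()) , (λ ())
    avoid (suc zero) zero = suc (suc zero) , (λ ()) , (λ ())
    avoid (suc (suc x)) zero = suc zero , (λ ()) , (λ ())

  firstLeaf : ∀ {m} → 2 ≤ m → Fin m
  firstLeaf {suc m} _ = zero

  splitNeighbour : ∀ {m} → 2 ≤ m → (q : QiType m) → ∃ λ b → splitAdj q b ≡ true
  splitNeighbour m≥2 complete = firstLeaf m≥2 , refl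
  splitNeighbour m≥2 starCenter = firstLeaf m≥2 , refl
  splitNeighbour m≥2 (starSpoke c) = c , ==-refl c

  q0Neighbour : ∀ {k} → 2 ≤ k → (q : Q0Type k) → (i : Fin k) → ∃ λ l → i ≢ l × q0Adj q i l ≡ true
  q0Neighbour k≥2 complete i = let (l , l≢i) = another k≥2 i in l , l≢i ∘ sym , q0Adj-complete (l≢i ∘ sym)
  q0Neighbour k≥2 (starTowards x) i = by-cases (i ≟ x)
    where
    by-cases : Dec (i ≡ x) → ∃ λ l → i ≢ l × q0Adj (starTowards x) i l ≡ true
    by-cases (yes refl) = let (l , l≢i) = another k≥2 i in l , l≢i ∘ sym , q0Adj-from-center l≢i
    by-cases (no i≢x) = x , i≢x , q0Adj-to-center i≢x

  QiType-unique : ∀ {m} → 2 ≤ m → (q q′ : QiType m) → (∀ a → splitAdj q a ≡ splitAdj q′ a)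
    → (∀ a b → leafAdj q a b ≡ leafAdj q′ a b) → q ≡ q′
  QiType-unique {suc zero} (s≤s ()) _ _ _ _
  QiType-unique {suc (suc m)} _ complete complete _ _ = refl
  QiType-unique {suc (suc m)} _ complete starCenter _ leaf = ⊥-elim (true≢false (leaf zero (suc zero)))
  QiType-unique {suc (suc m)} m≥2 complete (starSpoke c) split =
    let (a , a≢c) = another m≥2 c in ⊥-elim (true≢false (trans (split a) (≢⇒==-false a≢c)))
  QiType-unique {suc (suc m)} _ starCenter complete _ leaf = ⊥-elim (true≢false (sym (leaf zero (suc zero))))
  QiType-unique {suc (suc m)} _ starCenter starCenter _ _ = refl
  QiType-unique {suc (suc m)} m≥2 starCenter (starSpoke c) split =
    let (a , a≢c) = another m≥2 c in ⊥-elim (true≢false (trans (split a) (≢⇒==-false a≢c)))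
  QiType-unique {suc (suc m)} m≥2 (starSpoke c) complete split _ =
    let (a , a≢c) = another m≥2 c in ⊥-elim (true≢false (trans (sym (split a)) (≢⇒==-false a≢c)))
  QiType-unique {suc (suc m)} m≥2 (starSpoke c) starCenter split _ =
    let (a , a≢c) = another m≥2 c in ⊥-elim (true≢false (trans (sym (split a)) (≢⇒==-false a≢c)))
  QiType-unique {suc (suc m)} _ (starSpoke c) (starSpoke c′) split _ with c ≟ c′
  ... | yes refl = refl
  ... | no c≢c′ = ⊥-elim (true≢false (trans (sym (==-refl c)) (trans (split c) (≢⇒==-false c≢c′))))

  -- As k ≥ 3, a star on t_1, …, t_k has two non-adjacent leaves, and two different stars disagree on some pair.
  Q0Type-unique : ∀ {k} → 3 ≤ k → (q q′ : Q0Type k) → (∀ i l → i ≢ l → q0Adj q i l ≡ q0Adj q′ i l) → q ≡ q′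
  Q0Type-unique k≥3 complete complete _ = refl
  Q0Type-unique k≥3 complete (starTowards x) same = ⊥-elim (complete≢star x (λ i l i≢l → sym (same i l i≢l)))
    where
    complete≢star : ∀ x → ¬ (∀ i l → i ≢ l → q0Adj (starTowards x) i l ≡ q0Adj complete i l)
    complete≢star x same′ =
      true≢false (trans (sym (q0Adj-complete y≢z)) (trans (sym (same′ y z y≢z)) (q0Adj-between-leaves y≢x z≢x)))
      where
      y z : Fin _
      y = proj₁ (another₂ k≥3 x x)
      y≢x = proj₁ (proj₂ (another₂ k≥3 x x))
      z = proj₁ (another₂ k≥3 x y)
      z≢x = proj₁ (proj₂ (another₂ k≥3 x y))
      y≢z : y ≢ z
      y≢z = proj₂ (proj₂ (another₂ k≥3 x y)) ∘ sym
  Q0Type-unique k≥3 (starTowards x) complete same =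
    sym (Q0Type-unique k≥3 complete (starTowards x) (λ i l i≢l → sym (same i l i≢l)))
  Q0Type-unique k≥3 (starTowards x) (starTowards y) same with x ≟ y
  ... | yes refl = refl
  ... | no x≢y = ⊥-elim (true≢false (trans (sym (q0Adj-from-center z≢y))
    (trans (sym (same y z (z≢y ∘ sym))) (q0Adj-between-leaves (x≢y ∘ sym) z≢x))))
    where
    z = proj₁ (another₂ k≥3 x y)
    z≢x = proj₁ (proj₂ (another₂ k≥3 x y))
    z≢y = proj₂ (proj₂ (another₂ k≥3 x y))

  -- Adjacencies inside V_i recover Q_i's leaf edges; an edge from a into another part exists iff a sees s_i.
  splitDec-unique : ∀ {k} {n : Fin k → ℕ} → 3 ≤ k → (∀ i → 2 ≤ n i) → (D E : SplitDec k n)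
    → reconstruct D ≈G reconstruct E → (Q0 D ≡ Q0 E) × (∀ i → Q D i ≡ Q E i)
  splitDec-unique {k} {n} k≥3 n≥2 D E D≈E = Q0Type-unique k≥3 (Q0 D) (Q0 E) q0Adj-same , Q-same
    where
    k≥2 : 2 ≤ k
    k≥2 = ≤-trans (n≤1+n 2) k≥3
    splitAdj-transfer : ∀ (X Y : SplitDec k n) → reconstruct X ≈G reconstruct Y
      → ∀ i a → splitAdj (Q X i) a ≡ true → splitAdj (Q Y i) a ≡ true
    splitAdj-transfer X Y X≈Y i a sees with q0Neighbour k≥2 (Q0 X) i
    ... | l , i≢l , t-adj with splitNeighbour (n≥2 l) (Q X l)
    ...   | b , s-adj = ∧-conicalˡ _ _ (begin
      splitAdj (Q Y i) a ∧ q0Adj (Q0 Y) i l ∧ splitAdj (Q Y l) b ≡⟨ reconstruct-across Y i≢l a b ⟨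
      reconstruct Y (i , a) (l , b)                              ≡⟨ X≈Y (i , a) (l , b) ⟨
      reconstruct X (i , a) (l , b)                              ≡⟨ reconstruct-across X i≢l a b ⟩
      splitAdj (Q X i) a ∧ q0Adj (Q0 X) i l ∧ splitAdj (Q X l) b ≡⟨ cong₂ (λ x y → x ∧ y ∧ splitAdj (Q X l) b) sees t-adj ⟩
      splitAdj (Q X l) b                                         ≡⟨ s-adj ⟩
      true                                                       ∎)
      where open ≡-Reasoning
    splitAdj-same : ∀ i a → splitAdj (Q D i) a ≡ splitAdj (Q E i) a
    splitAdj-same i a with splitAdj (Q D i) a in d | splitAdj (Q E i) a in e
    ... | true | true = refl
    ... | false | false = refl
    ... | true | false = ⊥-elim (true≢false (trans (sym (splitAdj-transfer D E D≈E i a d)) e))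
    ... | false | true = ⊥-elim (true≢false (trans (sym (splitAdj-transfer E D (λ u w → sym (D≈E u w)) i a e)) d))
    Q-same : ∀ i → Q D i ≡ Q E i
    Q-same i = QiType-unique (n≥2 i) (Q D i) (Q E i) (splitAdj-same i)
      (λ a b → trans (sym (reconstruct-within D i a b)) (trans (D≈E (i , a) (i , b)) (reconstruct-within E i a b)))
    q0Adj-same : ∀ i l → i ≢ l → q0Adj (Q0 D) i l ≡ q0Adj (Q0 E) i l
    q0Adj-same i l i≢l with splitNeighbour (n≥2 i) (Q D i) | splitNeighbour (n≥2 l) (Q D l)
    ... | a , sa | b , sb = begin
      q0Adj (Q0 D) i l                                           ≡⟨ sees-both D sa sb ⟨
      splitAdj (Q D i) a ∧ q0Adj (Q0 D) i l ∧ splitAdj (Q D l) b ≡⟨ reconstruct-across D i≢l a b ⟨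
      reconstruct D (i , a) (l , b)                              ≡⟨ D≈E (i , a) (l , b) ⟩
      reconstruct E (i , a) (l , b)                              ≡⟨ reconstruct-across E i≢l a b ⟩
      splitAdj (Q E i) a ∧ q0Adj (Q0 E) i l ∧ splitAdj (Q E l) b ≡⟨ sees-both E (trans (sym (splitAdj-same i a)) sa) (trans (sym (splitAdj-same l b)) sb) ⟩
      q0Adj (Q0 E) i l                                           ∎
      where
      open ≡-Reasoning
      sees-both : ∀ X → splitAdj (Q X i) a ≡ true → splitAdj (Q X l) b ≡ true
        → (splitAdj (Q X i) a ∧ q0Adj (Q0 X) i l ∧ splitAdj (Q X l) b) ≡ q0Adj (Q0 X) i l
      sees-both X p q rewrite p | q = ∧-identityʳ _

  module Witnesses {k : ℕ} {n : Fin k → ℕ} (n≥2 : ∀ i → 2 ≤ n i) where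

    leaf : (i : Fin k) → Fin (n i)
    leaf i = firstLeaf (n≥2 i)

    leafVtx : Fin k → Vtx k n
    leafVtx i = (i , leaf i)

    -- A local complement at a leaf of a complete Q_i, i ≠ j, makes Q_i a star-spoke and leaves the
    -- other Q_l, l ≠ j, alone; sweeping over all i turns every Q_i with i ≠ j into a star-spoke.
    Prepared : Fin k → SplitDec k n → Set
    Prepared j D = (Q0 D ≡ starTowards j) × (∀ i → i ≢ j → (Q D i ≡ complete) ⊎ (Q D i ≡ starSpoke (leaf i)))

    lc-complete-leaf : ∀ j D i → Q0 D ≡ starTowards j → i ≢ j → Q D i ≡ complete
      → let D′ = lcSplitDec (leafVtx i) D in
        (Q0 D′ ≡ starTowards j) × (Q D′ i ≡ starSpoke (leaf i)) × (∀ l → l ≢ i → l ≢ j → Q D′ l ≡ Q D l)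
    lc-complete-leaf j D i q0≡ i≢j Qi≡ =
      trans (Q0-adj adj≡true) (trans (cong (lcQ0 i) q0≡) (lcQ0-leaf i≢j)) ,
      trans Q-self (cong (lcLeaf (leaf i)) Qi≡) ,
      λ l l≢i l≢j → Q-far l l≢i (trans (cong (λ q → q0Adj q i l) q0≡) (q0Adj-between-leaves i≢j l≢j))
      where
      open LCStep D i (leaf i)
      adj≡true : adj ≡ true
      adj≡true = cong (λ q → splitAdj q (leaf i)) Qi≡

    sweep : Fin k → List (Fin k) → SplitDec k n → List (Vtx k n)
    sweep j [] D = []
    sweep j (i ∷ is) D with i ≟ j | Q D i
    ... | no _ | complete = leafVtx i ∷ sweep j is (lcSplitDec (leafVtx i) D)
    ... | _ | _ = sweep j is D

    swept : Fin k → List (Fin k) → SplitDec k n → SplitDec k n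
    swept j is D = lcSplitDecs (sweep j is D) D

    SweepResult : Fin k → List (Fin k) → SplitDec k n → SplitDec k n → Set
    SweepResult j is D D′ =
      Prepared j D′ × (∀ i → i ≢ j → i ∈ is ⊎ Q D i ≡ starSpoke (leaf i) → Q D′ i ≡ starSpoke (leaf i))

    sweep-spokes : ∀ j is D → Prepared j D → SweepResult j is D (swept j is D)
    sweep-skip : ∀ j i is D → Prepared j D → (i ≢ j → Q D i ≡ starSpoke (leaf i)) → SweepResult j (i ∷ is) D (swept j is D)

    sweep-spokes j [] D prep = prep , λ { i i≢j (inj₂ s) → s }
    sweep-spokes j (i ∷ is) D prep@(q0≡ , kinds) with i ≟ j | Q D i in Qi≡
    ... | no i≢j | complete = proj₁ rec , spokes
      where
      D₁ = lcSplitDec (leafVtx i) D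
      step = lc-complete-leaf j D i q0≡ i≢j Qi≡
      prep₁ : Prepared j D₁
      prep₁ = proj₁ step , λ l l≢j → by-cases l l≢j (l ≟ i)
        where
        by-cases : ∀ l → l ≢ j → Dec (l ≡ i) → (Q D₁ l ≡ complete) ⊎ (Q D₁ l ≡ starSpoke (leaf l))
        by-cases l _ (yes refl) = inj₂ (proj₁ (proj₂ step))
        by-cases l l≢j (no l≢i) rewrite proj₂ (proj₂ step) l l≢i l≢j = kinds l l≢j
      rec = sweep-spokes j is D₁ prep₁
      spokes : ∀ l → l ≢ j → l ∈ i ∷ is ⊎ Q D l ≡ starSpoke (leaf l) → Q (swept j is D₁) l ≡ starSpoke (leaf l)
      spokes l l≢j (inj₁ (here refl)) = proj₂ rec l l≢j (inj₂ (proj₁ (proj₂ step)))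
      spokes l l≢j (inj₁ (there l∈is)) = proj₂ rec l l≢j (inj₁ l∈is)
      spokes l l≢j (inj₂ s) with l ≟ i
      ... | yes refl = proj₂ rec l l≢j (inj₂ (proj₁ (proj₂ step)))
      ... | no l≢i = proj₂ rec l l≢j (inj₂ (trans (proj₂ (proj₂ step) l l≢i l≢j) s))
    ... | yes i≡j | _ = sweep-skip j i is D prep (λ i≢j → ⊥-elim (i≢j i≡j))
    ... | no i≢j | starCenter = sweep-skip j i is D prep (λ _ → ⊥-elim (not-center (kinds i i≢j)))
      where
      not-center : ¬ ((Q D i ≡ complete) ⊎ (Q D i ≡ starSpoke (leaf i)))
      not-center (inj₁ c) with () ← trans (sym Qi≡) c
      not-center (inj₂ s) with () ← trans (sym Qi≡) s
    ... | no i≢j | starSpoke c = sweep-skip j i is D prep (λ _ → spoke (kinds i i≢j))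
      where
      spoke : (Q D i ≡ complete) ⊎ (Q D i ≡ starSpoke (leaf i)) → Q D i ≡ starSpoke (leaf i)
      spoke (inj₁ c) with () ← trans (sym Qi≡) c
      spoke (inj₂ s) = s

    sweep-skip j i is D prep i-spoke = proj₁ rec , spokes
      where
      rec = sweep-spokes j is D prep
      spokes : ∀ l → l ≢ j → l ∈ i ∷ is ⊎ Q D l ≡ starSpoke (leaf l) → Q (swept j is D) l ≡ starSpoke (leaf l)
      spokes l l≢j (inj₁ (here refl)) = proj₂ rec l l≢j (inj₂ (i-spoke l≢j))
      spokes l l≢j (inj₁ (there l∈is)) = proj₂ rec l l≢j (inj₁ l∈is)
      spokes l l≢j (inj₂ s) = proj₂ rec l l≢j (inj₂ s)

    -- For j ≢ r, complementing at V_r and then at V_j moves the centre of Q_0 from t_r to t_j.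
    prepared-start : ∀ r j → ∃ λ vs → Prepared j (lcSplitDecs vs (cliqueStarDec n r))
    prepared-start r j with j ≟ r
    ... | yes refl = [] , refl , (λ _ _ → inj₁ refl)
    ... | no j≢r = leafVtx r ∷ leafVtx j ∷ [] , q0₂ , kinds₂
      where
      module S₁ = LCStep (cliqueStarDec n r) r (leaf r)
      D₁ = S₁.D′
      q0₁ : Q0 D₁ ≡ complete
      q0₁ = lcQ0-center r
      others₁ : ∀ l → l ≢ r → Q D₁ l ≡ starCenter
      others₁ l l≢r = S₁.Q-near refl l l≢r (q0Adj-from-center l≢r)
      module S₂ = LCStep D₁ j (leaf j)
      adj₂ : S₂.adj ≡ true
      adj₂ = cong (λ q → splitAdj q (leaf j)) (others₁ j j≢r)
      q0₂ : Q0 S₂.D′ ≡ starTowards j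
      q0₂ = trans (S₂.Q0-adj adj₂) (cong (lcQ0 j) q0₁)
      kinds₂ : ∀ l → l ≢ j → (Q S₂.D′ l ≡ complete) ⊎ (Q S₂.D′ l ≡ starSpoke (leaf l))
      kinds₂ l l≢j with l ≟ r
      ... | yes refl = inj₂ (trans near (cong lcSplit S₁.Q-self))
        where near = S₂.Q-near adj₂ l l≢j (trans (cong (λ q → q0Adj q j l) q0₁) (q0Adj-complete (l≢j ∘ sym)))
      ... | no l≢r = inj₁ (trans near (cong lcSplit (others₁ l l≢r)))
        where near = S₂.Q-near adj₂ l l≢j (trans (cong (λ q → q0Adj q j l) q0₁) (q0Adj-complete (l≢j ∘ sym)))

    spoke-witness : ∀ r j → ∃ λ vs → let D = lcSplitDecs vs (cliqueStarDec n r) in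
      (Q0 D ≡ starTowards j) × (∀ i → i ≢ j → Q D i ≡ starSpoke (leaf i))
    spoke-witness r j = vs ++ sweep j (allFin k) D₀ ,
      subst Spoked (sym (lcSplitDecs-++ vs _ (cliqueStarDec n r)))
        (proj₁ (proj₁ swept-ok) , λ i i≢j → proj₂ swept-ok i i≢j (inj₁ (∈-allFin i)))
      where
      vs = proj₁ (prepared-start r j)
      D₀ = lcSplitDecs vs (cliqueStarDec n r)
      swept-ok = sweep-spokes j (allFin k) D₀ (proj₂ (prepared-start r j))
      Spoked : SplitDec k n → Set
      Spoked D = (Q0 D ≡ starTowards j) × (∀ i → i ≢ j → Q D i ≡ starSpoke (leaf i))

    lc-complete-center : ∀ j D → Q0 D ≡ starTowards j → Q D j ≡ complete → (∀ i → i ≢ j → IsStarSpoke (Q D i))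
      → Shape2 (lcSplitDec (leafVtx j) D)
    lc-complete-center j D q0≡ Qj≡ spokes =
      trans (Q0-adj adj≡true) (trans (cong (lcQ0 j) q0≡) (lcQ0-center j)) ,
      everywhere (λ _ q → IsStarSpoke q) (leaf j , trans Q-self (cong (lcLeaf (leaf j)) Qj≡))
        (λ l l≢j → let (c , Ql≡) = spokes l l≢j in
          c , trans (Q-near adj≡true l l≢j (trans (cong (λ q → q0Adj q j l) q0≡) (q0Adj-from-center l≢j))) (cong lcSplit Ql≡))
      where
      open LCStep D j (leaf j)
      adj≡true : adj ≡ true
      adj≡true = cong (λ q → splitAdj q (leaf j)) Qj≡

  module _ {k : ℕ} {n : Fin k → ℕ} (D : SplitDec k n) where

    deg inner : Fin k → ℕ
    deg i = splitDeg (Q D i)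
    inner i = innerArcs (Q D i)

    arcsOf : ℕ
    arcsOf = arcs (reconstruct D)

    reach-complete : Q0 D ≡ complete → ∀ i → reach D i ≡ ∑ k (except i deg)
    reach-complete q0≡ i = ∑-cong k pointwise
      where
      pointwise : ∀ l → ⟦ q0Adj (Q0 D) i l ⟧ * deg l ≡ except i deg l
      pointwise l rewrite q0≡ | ==-sym i l with l == i
      ... | true = refl
      ... | false = +-identityʳ (deg l)

    reach-center : ∀ x → Q0 D ≡ starTowards x → reach D x ≡ ∑ k (except x deg)
    reach-center x q0≡ = ∑-cong k pointwise
      where
      pointwise : ∀ l → ⟦ q0Adj (Q0 D) x l ⟧ * deg l ≡ except x deg l
      pointwise l rewrite q0≡ | ==-sym x l | ==-refl x with l == x
      ... | true = refl
      ... | false = +-identityʳ (deg l)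

    reach-leaf : ∀ x i → Q0 D ≡ starTowards x → i ≢ x → reach D i ≡ deg x
    reach-leaf x i q0≡ i≢x = trans (∑-point k _ x vanish) (trans (cong (λ b → ⟦ b ⟧ * deg x) adjacent) (+-identityʳ (deg x)))
      where
      adjacent : q0Adj (Q0 D) i x ≡ true
      adjacent = trans (cong (λ q → q0Adj q i x) q0≡) (q0Adj-to-center i≢x)
      vanish : ∀ l → l ≢ x → ⟦ q0Adj (Q0 D) i l ⟧ * deg l ≡ 0
      vanish l l≢x rewrite q0≡ | q0Adj-between-leaves i≢x l≢x = refl

    arcs-complete : Q0 D ≡ complete → arcsOf ≡ ∑ k (λ i → inner i + deg i * ∑ k (except i deg))
    arcs-complete q0≡ = trans (arcs-reconstruct D) (∑-cong k (λ i → cong (λ z → inner i + deg i * z) (reach-complete q0≡ i)))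

    starTerm : Fin k → ℕ → Fin k → ℕ
    starTerm x c i = if i == x then c else inner i + 2 * (deg x * deg i)

    -- Adding a term c for the centre x on both sides makes the right-hand side a sum over all indices.
    arcs-star : ∀ x → Q0 D ≡ starTowards x → ∀ c → arcsOf + c ≡ inner x + ∑ k (starTerm x c)
    arcs-star x q0≡ c = begin
      arcsOf + c
        ≡⟨ cong (_+ c) (trans (arcs-reconstruct D) (∑-split k _ x)) ⟩
      inner x + deg x * reach D x + ∑ k (except x (λ i → inner i + deg i * reach D i)) + c
        ≡⟨ cong₂ (λ a b → inner x + deg x * a + b + c) (reach-center x q0≡)
             (∑-except-cong k x (λ i i≢x → cong (λ z → inner i + deg i * z) (reach-leaf x i q0≡ i≢x))) ⟩
      inner x + deg x * ∑ k (except x deg) + ∑ k (except x (λ i → inner i + deg i * deg x)) + c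
        ≡⟨ cong (λ a → inner x + a + ∑ k (except x (λ i → inner i + deg i * deg x)) + c) (∑-except-distribˡ-* k x (deg x) deg) ⟨
      inner x + X + Y + c
        ≡⟨ regroup (inner x) X Y c ⟩
      inner x + (c + (X + Y))
        ≡⟨ cong (λ z → inner x + (c + z)) (∑-except-distrib-+ k x _ _) ⟨
      inner x + (c + ∑ k (except x (λ i → deg x * deg i + (inner i + deg i * deg x))))
        ≡⟨ cong (λ z → inner x + (c + z)) (∑-except-cong k x (λ i _ → double (deg x) (deg i) (inner i))) ⟩
      inner x + (c + ∑ k (except x (λ i → inner i + 2 * (deg x * deg i))))
        ≡⟨ cong (inner x +_) (trans (∑-split k (starTerm x c) x) (cong₂ _+_ at-x (∑-except-cong k x elsewhere))) ⟨
      inner x + ∑ k (starTerm x c) ∎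
      where
      open ≡-Reasoning
      X = ∑ k (except x (λ i → deg x * deg i))
      Y = ∑ k (except x (λ i → inner i + deg i * deg x))
      regroup : ∀ a b c′ e → a + b + c′ + e ≡ a + (e + (b + c′))
      regroup = solve-∀
      double : ∀ a b c′ → a * b + (c′ + b * a) ≡ c′ + 2 * (a * b)
      double = solve-∀
      at-x : starTerm x c x ≡ c
      at-x rewrite ==-refl x = refl
      elsewhere : ∀ i → i ≢ x → starTerm x c i ≡ inner i + 2 * (deg x * deg i)
      elsewhere i i≢x rewrite ≢⇒==-false i≢x = refl

  -- The share in arcs of a star-spoke, resp. complete, Q_i with |V_i| = m whose split-node s_i
  -- is joined to c vertices outside V_i (Q_i contributes its inner arcs and twice its cross edges).
  spokeArcs completeArcs : ℕ → ℕ → ℕ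
  spokeArcs m c = 2 * (m ∸ 1) + 2 * c
  completeArcs m c = m * (m ∸ 1) + 2 * (c * m)

  +≡⇒≤ : ∀ {a b} r → a + r ≡ b → a ≤ b
  +≡⇒≤ {a} r e = subst (a ≤_) e (m≤m+n a r)

  spoke-term : ∀ m c → (m ∸ 1) + (m ∸ 1) + 2 * (c * 1) ≡ spokeArcs m c
  spoke-term m c = regroup (m ∸ 1) c
    where
    regroup : ∀ t c → t + t + 2 * (c * 1) ≡ 2 * t + 2 * c
    regroup = solve-∀

  spokeArcs<completeArcs : ∀ m c → 2 ≤ m → 1 ≤ c → spokeArcs m c + 1 ≤ completeArcs m c
  spokeArcs<completeArcs (suc zero) _ (s≤s ()) _
  spokeArcs<completeArcs (suc (suc p)) (suc q) _ _ = +≡⇒≤ (1 + 3 * p + p * p + 2 * q + 2 * p * q) (identity p q)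
    where
    identity : ∀ p q → 2 * suc p + 2 * suc q + 1 + (1 + 3 * p + p * p + 2 * q + 2 * p * q)
      ≡ suc (suc p) * suc p + 2 * (suc q * suc (suc p))
    identity = solve-∀

  spokeArcs-monoʳ-≤ : ∀ m {c c′} → c ≤ c′ → spokeArcs m c ≤ spokeArcs m c′
  spokeArcs-monoʳ-≤ m c≤c′ = +-monoʳ-≤ (2 * (m ∸ 1)) (*-monoʳ-≤ 2 c≤c′)

  spokeArcs-shift : ∀ x l → 1 ≤ l → l ≤ x → spokeArcs x l ≡ spokeArcs l l + 2 * (x ∸ l)
  spokeArcs-shift (suc x) (suc l) _ (s≤s l≤x) =
    subst (λ x → spokeArcs (suc x) (suc l) ≡ spokeArcs (suc l) (suc l) + 2 * (x ∸ l)) (m+[n∸m]≡n l≤x) (shifted (x ∸ l))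
    where
    identity : ∀ l c → 2 * (l + c) + 2 * suc l ≡ 2 * l + 2 * suc l + 2 * c
    identity = solve-∀
    shifted : ∀ c → spokeArcs (suc (l + c)) (suc l) ≡ spokeArcs (suc l) (suc l) + 2 * ((l + c) ∸ l)
    shifted c rewrite m+n∸m≡n l c = identity l c

  completeArcs-bound-≤ : ∀ x l → 2 ≤ x → x ≤ l → spokeArcs l x + (x * (x ∸ 1) + 1) ≤ completeArcs l x
  completeArcs-bound-≤ (suc zero) _ (s≤s ()) _
  completeArcs-bound-≤ (suc (suc a)) l _ x≤l =
    subst (λ l → spokeArcs l (2 + a) + ((2 + a) * (1 + a) + 1) ≤ completeArcs l (2 + a)) (m+[n∸m]≡n x≤l) (bound (l ∸ (2 + a)))
    where
    identity : ∀ a b → 2 * (suc a + b) + 2 * (2 + a) + ((2 + a) * suc a + 1) + (1 + 4 * a + 5 * b + 2 * a * a + 4 * a * b + b * b)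
      ≡ (2 + a + b) * (suc a + b) + 2 * ((2 + a) * (2 + a + b))
    identity = solve-∀
    bound : ∀ b → spokeArcs (2 + a + b) (2 + a) + ((2 + a) * (1 + a) + 1) ≤ completeArcs (2 + a + b) (2 + a)
    bound b = +≡⇒≤ (1 + 4 * a + 5 * b + 2 * a * a + 4 * a * b + b * b) (identity a b)

  completeArcs-bound-> : ∀ x l → 2 ≤ l → l < x → spokeArcs l l + (l * (l ∸ 1) + 1 + 2 * (x ∸ l)) ≤ completeArcs l x
  completeArcs-bound-> x (suc zero) (s≤s ()) _
  completeArcs-bound-> x (suc (suc a)) _ l<x = subst P (m+[n∸m]≡n l<x) (bound (x ∸ (3 + a)))
    where
    L = 2 + a
    P : ℕ → Set
    P x = spokeArcs L L + (L * (L ∸ 1) + 1 + 2 * (x ∸ L)) ≤ completeArcs L x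
    identity : ∀ a b → 2 * suc a + 2 * (2 + a) + ((2 + a) * suc a + 1 + 2 * suc b) + (3 + 6 * a + 2 * a * a + 2 * b + 2 * a * b)
      ≡ (2 + a) * suc a + 2 * ((3 + a + b) * (2 + a))
    identity = solve-∀
    gap : ∀ b → (3 + a + b) ∸ L ≡ suc b
    gap b = trans (cong (_∸ a) (sym (+-suc a b))) (m+n∸m≡n a (suc b))
    bound : ∀ b → P (3 + a + b)
    bound b rewrite gap b = +≡⇒≤ (3 + 6 * a + 2 * a * a + 2 * b + 2 * a * b) (identity a b)

  center-term-≥ : ∀ m N → 2 ≤ m → 2 ≤ N → 2 * (m ∸ 1) + N ≤ 0 + m * N
  center-term-≥ (suc zero) _ (s≤s ()) _
  center-term-≥ (suc (suc a)) (suc zero) _ (s≤s ())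
  center-term-≥ (suc (suc a)) (suc (suc b)) _ _ = +≡⇒≤ (b + a * b) (identity a b)
    where
    identity : ∀ a b → 2 * suc a + (2 + b) + (b + a * b) ≡ (2 + a) * (2 + b)
    identity = solve-∀

  triangle : ℕ → ℕ
  triangle zero = 0
  triangle (suc x) = suc x + triangle x

  2*triangle : ∀ x → 2 * triangle x ≡ x * suc x
  2*triangle zero = refl
  2*triangle (suc x) = trans (*-distribˡ-+ 2 (suc x) (triangle x))
    (trans (cong (2 * suc x +_) (2*triangle x)) (identity x))
    where
    identity : ∀ x → 2 * suc x + x * suc x ≡ suc x * suc (suc x)
    identity = solve-∀

  2*[x*[1+x]/2] : ∀ x → 2 * ((x * suc x) / 2) ≡ x * suc x
  2*[x*[1+x]/2] x = begin
    2 * ((x * suc x) / 2)           ≡⟨ cong (λ z → 2 * (z / 2)) (2*triangle x) ⟨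
    2 * ((2 * triangle x) / 2)      ≡⟨ cong (λ z → 2 * (z / 2)) (*-comm 2 (triangle x)) ⟩
    2 * ((triangle x * 2) / 2)      ≡⟨ cong (2 *_) (m*n/n≡m (triangle x) 2) ⟩
    2 * triangle x                  ≡⟨ 2*triangle x ⟩
    x * suc x                       ∎
    where open ≡-Reasoning

  2*[x*[x∸1]/2] : ∀ x → 1 ≤ x → 2 * ((x * (x ∸ 1)) / 2) ≡ x * (x ∸ 1)
  2*[x*[x∸1]/2] (suc y) _ = trans (cong (λ z → 2 * (z / 2)) (*-comm (suc y) y)) (trans (2*[x*[1+x]/2] y) (*-comm y (suc y)))

  difference-pos : ∀ A B → ℤ.+ 0 ℤ.< ℤ.+ A ℤ.- ℤ.+ B → B < A
  difference-pos A B 0<d with B <? A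
  ... | yes B<A = B<A
  ... | no B≮A = ⊥-elim (ℤP.<⇒≱ 0<d (begin
    ℤ.+ A ℤ.- ℤ.+ B ≡⟨ ℤP.[+m]-[+n]≡m⊖n A B ⟩
    A ℤ.⊖ B         ≤⟨ ℤP.⊖-monoˡ-≤ B (≮⇒≥ B≮A) ⟩
    B ℤ.⊖ B         ≡⟨ ℤP.n⊖n≡0 B ⟩
    ℤ.+ 0           ∎))
    where open ℤP.≤-Reasoning

  difference-neg : ∀ A B → ℤ.+ A ℤ.- ℤ.+ B ℤ.< ℤ.+ 0 → A < B
  difference-neg A B d<0 with A <? B
  ... | yes A<B = A<B
  ... | no A≮B = ⊥-elim (ℤP.<⇒≱ d<0 (begin
    ℤ.+ 0           ≡⟨ ℤP.n⊖n≡0 B ⟨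
    B ℤ.⊖ B         ≤⟨ ℤP.⊖-monoˡ-≤ B (≮⇒≥ A≮B) ⟩
    A ℤ.⊖ B         ≡⟨ ℤP.[+m]-[+n]≡m⊖n A B ⟨
    ℤ.+ A ℤ.- ℤ.+ B ∎))
    where open ℤP.≤-Reasoning

  difference-zero : ∀ A B → ℤ.+ A ℤ.- ℤ.+ B ≡ ℤ.+ 0 → A ≡ B
  difference-zero A B d≡0 with <-cmp A B
  ... | tri< A<B _ _ =
    ⊥-elim (ℤP.<-irrefl d≡0 (subst₂ ℤ._<_ (sym (ℤP.[+m]-[+n]≡m⊖n A B)) (ℤP.n⊖n≡0 B) (ℤP.⊖-monoˡ-< B A<B)))
  ... | tri≈ _ A≡B _ = A≡B
  ... | tri> _ _ B<A =
    ⊥-elim (ℤP.<-irrefl (sym d≡0) (subst₂ ℤ._<_ (ℤP.n⊖n≡0 B) (sym (ℤP.[+m]-[+n]≡m⊖n A B)) (ℤP.⊖-monoˡ-< B B<A)))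

  -- Lower bounds on arcs

  splitDeg-notSpoke : ∀ {m} (q : QiType m) → isSpoke q ≡ false → splitDeg q ≡ m
  splitDeg-notSpoke complete _ = refl
  splitDeg-notSpoke starCenter _ = refl

  splitDeg≥1 : ∀ {m} (q : QiType m) → 1 ≤ m → 1 ≤ splitDeg q
  splitDeg≥1 complete m≥1 = m≥1
  splitDeg≥1 starCenter m≥1 = m≥1
  splitDeg≥1 (starSpoke c) _ = s≤s z≤n

  star-leaf-term-≥ : ∀ {m} (q : QiType m) c c′ → 2 ≤ m → 1 ≤ c → c′ ≤ c → isCenter q ≡ false
    → spokeArcs m c′ ≤ innerArcs q + 2 * (c * splitDeg q)
  star-leaf-term-≥ {m} complete c c′ m≥2 c≥1 c′≤c _ =
    ≤-trans (spokeArcs-monoʳ-≤ m c′≤c) (≤-trans (m≤m+n _ 1) (spokeArcs<completeArcs m c m≥2 c≥1))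
  star-leaf-term-≥ {m} (starSpoke x) c c′ m≥2 c≥1 c′≤c _ =
    ≤-trans (spokeArcs-monoʳ-≤ m c′≤c) (≤-reflexive (sym (spoke-term m c)))

  star-leaf-term-spoke : ∀ {m} (q : QiType m) c → isSpoke q ≡ true → innerArcs q + 2 * (c * splitDeg q) ≡ spokeArcs m c
  star-leaf-term-spoke {m} (starSpoke x) c _ = spoke-term m c

  module Targets {k : ℕ} {n : Fin k → ℕ} (k≥3 : 3 ≤ k) (n≥2 : ∀ i → 2 ≤ n i) where

    n≥1 : ∀ i → 1 ≤ n i
    n≥1 i = ≤-trans (s≤s z≤n) (n≥2 i)

    pendants : ℕ
    pendants = ∑ k (λ i → n i ∸ 1)

    -- edges₁ y is the edge count in (1) with Q_y star-center; arcs₁, arcs₂, arcs₃ are twice the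
    -- edge counts in (1), (2), (3).
    edges₁ : Fin k → ℕ
    edges₁ y = n y * (k ∸ 1) + ∑ k (except y (λ i → n i ∸ 1))

    arcs₁ arcs₃ : Fin k → ℕ
    arcs₁ y = 2 * edges₁ y
    arcs₃ y = arcs₁ y + n y * (n y ∸ 1)

    arcs₂ : ℕ
    arcs₂ = ∑ k (λ i → 2 * (n i ∸ 1) + (k ∸ 1))

    spokeTotal : Fin k → ℕ
    spokeTotal y = ∑ k (λ i → spokeArcs (n i) (n y))

    spokeTotal≡arcs₁ : ∀ y → spokeTotal y ≡ arcs₁ y + spokeArcs (n y) (n y)
    spokeTotal≡arcs₁ y = trans (∑-split k _ y) (trans (+-comm (spokeArcs (n y) (n y)) _) (cong (_+ spokeArcs (n y) (n y)) others))
      where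
      others : ∑ k (except y (λ i → spokeArcs (n i) (n y))) ≡ arcs₁ y
      others = trans (∑-except-distrib-+ k y _ _)
        (trans (cong₂ _+_ (∑-except-distribˡ-* k y 2 (λ i → n i ∸ 1)) (∑-except-const k y (2 * n y)))
          (regroup (∑ k (except y (λ i → n i ∸ 1))) (k ∸ 1) (n y)))
        where
        regroup : ∀ S u c → 2 * S + u * (2 * c) ≡ 2 * (c * u + S)
        regroup = solve-∀

    module StarBounds (D : SplitDec k n) (x : Fin k) (q0≡ : Q0 D ≡ starTowards x) (x-notSpoke : isSpoke (Q D x) ≡ false)
                      (noCenter : ∀ i → i ≢ x → isCenter (Q D i) ≡ false) where

      deg-x : deg D x ≡ n x
      deg-x = splitDeg-notSpoke (Q D x) x-notSpoke

      starTerm-leaf : ∀ c i → i ≢ x → starTerm D x c i ≡ inner D i + 2 * (n x * deg D i)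
      starTerm-leaf c i i≢x rewrite ≢⇒==-false i≢x | deg-x = refl

      starTerm-center : ∀ c → starTerm D x c x ≡ c
      starTerm-center c rewrite ==-refl x = refl

      starTerm-≥ : ∀ y → n y ≤ n x → ∀ i → spokeArcs (n i) (n y) ≤ starTerm D x (spokeArcs (n x) (n y)) i
      starTerm-≥ y y≤x i = by-cases (i ≟ x)
        where
        by-cases : Dec (i ≡ x) → spokeArcs (n i) (n y) ≤ starTerm D x (spokeArcs (n x) (n y)) i
        by-cases (yes refl) = ≤-reflexive (sym (starTerm-center _))
        by-cases (no i≢x) = subst (spokeArcs (n i) (n y) ≤_) (sym (starTerm-leaf _ i i≢x))
          (star-leaf-term-≥ (Q D i) (n x) (n y) (n≥2 i) (n≥1 x) y≤x (noCenter i i≢x))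

      lower : ∀ y → n y ≤ n x → ∀ l e → spokeArcs (n l) (n y) + e ≤ starTerm D x (spokeArcs (n x) (n y)) l
        → inner D x + spokeTotal y + e ≤ arcsOf D + spokeArcs (n x) (n y)
      lower y y≤x l e bump = begin
        inner D x + spokeTotal y + e                           ≡⟨ +-assoc (inner D x) _ e ⟩
        inner D x + (spokeTotal y + e)                         ≤⟨ +-monoʳ-≤ (inner D x) (∑-bump k l e (starTerm-≥ y y≤x) bump) ⟩
        inner D x + ∑ k (starTerm D x (spokeArcs (n x) (n y))) ≡⟨ arcs-star D x q0≡ _ ⟨
        arcsOf D + spokeArcs (n x) (n y)                       ∎
        where open ≤-Reasoning

      lower-at-x : ∀ l e → spokeArcs (n l) (n x) + e ≤ starTerm D x (spokeArcs (n x) (n x)) l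
        → inner D x + arcs₁ x + e ≤ arcsOf D
      lower-at-x l e bump = +-cancelʳ-≤ (spokeArcs (n x) (n x)) _ _
        (subst (_≤ arcsOf D + spokeArcs (n x) (n x)) regrouped (lower x ≤-refl l e bump))
        where
        regroup : ∀ a b c e → a + (b + c) + e ≡ a + b + e + c
        regroup = solve-∀
        regrouped : inner D x + spokeTotal x + e ≡ inner D x + arcs₁ x + e + spokeArcs (n x) (n x)
        regrouped rewrite spokeTotal≡arcs₁ x = regroup (inner D x) (arcs₁ x) _ e

      arcs₁-≤ : inner D x + arcs₁ x ≤ arcsOf D
      arcs₁-≤ = subst (_≤ arcsOf D) (+-identityʳ _)
        (lower-at-x x 0 (≤-trans (≤-reflexive (+-identityʳ _)) (starTerm-≥ x ≤-refl x)))

      arcs₁-<-complete : ∀ l → l ≢ x → Q D l ≡ complete → inner D x + arcs₁ x + 1 ≤ arcsOf D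
      arcs₁-<-complete l l≢x Ql≡ = lower-at-x l 1 bump
        where
        bump : spokeArcs (n l) (n x) + 1 ≤ starTerm D x (spokeArcs (n x) (n x)) l
        bump rewrite starTerm-leaf (spokeArcs (n x) (n x)) l l≢x | Ql≡ = spokeArcs<completeArcs (n l) (n x) (n≥2 l) (n≥1 x)

      arcs-spokes : (∀ i → i ≢ x → isSpoke (Q D i) ≡ true) → arcsOf D ≡ inner D x + arcs₁ x
      arcs-spokes spokes = +-cancelʳ-≡ (spokeArcs (n x) (n x)) _ _ (begin
        arcsOf D + spokeArcs (n x) (n x)                       ≡⟨ arcs-star D x q0≡ _ ⟩
        inner D x + ∑ k (starTerm D x (spokeArcs (n x) (n x))) ≡⟨ cong (inner D x +_) (∑-cong k pointwise) ⟩
        inner D x + spokeTotal x                               ≡⟨ cong (inner D x +_) (spokeTotal≡arcs₁ x) ⟩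
        inner D x + (arcs₁ x + spokeArcs (n x) (n x))          ≡⟨ +-assoc (inner D x) _ _ ⟨
        inner D x + arcs₁ x + spokeArcs (n x) (n x)            ∎)
        where
        open ≡-Reasoning
        pointwise : ∀ i → starTerm D x (spokeArcs (n x) (n x)) i ≡ spokeArcs (n i) (n x)
        pointwise i = by-cases (i ≟ x)
          where
          by-cases : Dec (i ≡ x) → starTerm D x (spokeArcs (n x) (n x)) i ≡ spokeArcs (n i) (n x)
          by-cases (yes refl) = starTerm-center _
          by-cases (no i≢x) = trans (starTerm-leaf _ i i≢x) (star-leaf-term-spoke (Q D i) (n x) (spokes i i≢x))

      arcs₃-<-center-complete-≤ : Q D x ≡ starCenter → ∀ l → l ≢ x → Q D l ≡ complete → n x ≤ n l
        → arcs₃ x + 1 ≤ arcsOf D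
      arcs₃-<-center-complete-≤ Qx≡ l l≢x Ql≡ x≤l =
        subst (_≤ arcsOf D) regrouped (lower-at-x l (n x * (n x ∸ 1) + 1) bump)
        where
        regroup : ∀ a b → 0 + a + (b + 1) ≡ a + b + 1
        regroup = solve-∀
        regrouped : inner D x + arcs₁ x + (n x * (n x ∸ 1) + 1) ≡ arcs₃ x + 1
        regrouped rewrite cong innerArcs Qx≡ = regroup (arcs₁ x) _
        bump : spokeArcs (n l) (n x) + (n x * (n x ∸ 1) + 1) ≤ starTerm D x (spokeArcs (n x) (n x)) l
        bump rewrite starTerm-leaf (spokeArcs (n x) (n x)) l l≢x | Ql≡ = completeArcs-bound-≤ (n x) (n l) (n≥2 x) x≤l

      arcs₃-<-center-complete-> : Q D x ≡ starCenter → ∀ l → l ≢ x → Q D l ≡ complete → n l < n x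
        → arcs₃ l + 1 ≤ arcsOf D
      arcs₃-<-center-complete-> Qx≡ l l≢x Ql≡ l<x = +-cancelʳ-≤ (spokeArcs (n x) (n l)) _ _
        (subst (_≤ arcsOf D + spokeArcs (n x) (n l)) regrouped (lower l (<⇒≤ l<x) l E bump))
        where
        E = n l * (n l ∸ 1) + 1 + 2 * (n x ∸ n l)
        regroup : ∀ a b c e → 0 + (a + b) + (c + 1 + e) ≡ a + c + 1 + (b + e)
        regroup = solve-∀
        regrouped : inner D x + spokeTotal l + E ≡ arcs₃ l + 1 + spokeArcs (n x) (n l)
        regrouped rewrite spokeTotal≡arcs₁ l | cong innerArcs Qx≡ | spokeArcs-shift (n x) (n l) (n≥1 l) (<⇒≤ l<x) =
          regroup (arcs₁ l) (spokeArcs (n l) (n l)) (n l * (n l ∸ 1)) (2 * (n x ∸ n l))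
        bump : spokeArcs (n l) (n l) + E ≤ starTerm D x (spokeArcs (n x) (n l)) l
        bump rewrite starTerm-leaf (spokeArcs (n x) (n l)) l l≢x | Ql≡ = completeArcs-bound-> (n x) (n l) (n≥2 l) l<x

    ∑-two-terms : ∀ (g : Fin k → ℕ) a b → b ≢ a → g a + g b ≤ ∑ k g
    ∑-two-terms g a b b≢a = subst (g a + g b ≤_) (sym (∑-split k g a))
      (+-monoʳ-≤ (g a) (subst (_≤ ∑ k (except a g)) (except-other g b≢a) (∑-term-≤ k (except a g) b)))

    module CompleteBounds (D : SplitDec k n) (q0≡ : Q0 D ≡ complete) (noComplete : ∀ i → isComplete (Q D i) ≡ false) where

      reachSum term : Fin k → ℕ
      reachSum i = ∑ k (except i (deg D))
      term i = inner D i + deg D i * reachSum i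

      deg≥1 : ∀ i → 1 ≤ deg D i
      deg≥1 i = splitDeg≥1 (Q D i) (n≥1 i)

      reachSum≥k-1 : ∀ i → k ∸ 1 ≤ reachSum i
      reachSum≥k-1 i = subst (_≤ reachSum i) (trans (∑-except-const k i 1) (*-identityʳ _))
        (∑-except-mono-≤ k i (λ l _ → deg≥1 l))

      term-≥ : ∀ i → 2 ≤ reachSum i → 2 * (n i ∸ 1) + reachSum i ≤ term i
      term-≥ i N≥2 = by-kind (Q D i) refl
        where
        regroup : ∀ t N → 2 * t + N ≡ t + t + 1 * N
        regroup = solve-∀
        by-kind : (q : QiType (n i)) → Q D i ≡ q → 2 * (n i ∸ 1) + reachSum i ≤ term i
        by-kind complete e = ⊥-elim (true≢false (trans (cong isComplete (sym e)) (noComplete i)))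
        by-kind starCenter e rewrite e = center-term-≥ (n i) (reachSum i) (n≥2 i) N≥2
        by-kind (starSpoke c) e rewrite e = ≤-reflexive (regroup (n i ∸ 1) (reachSum i))

      k-1≥2 : 2 ≤ k ∸ 1
      k-1≥2 = ∸-monoˡ-≤ 1 k≥3

      arcs₁-<-center : ∀ s → Q D s ≡ starCenter → arcs₁ s + 1 ≤ arcsOf D
      arcs₁-<-center s Qs≡ = begin
        arcs₁ s + 1                                              ≤⟨ +-monoʳ-≤ (arcs₁ s) (≤-trans (s≤s z≤n) k-1≥2) ⟩
        arcs₁ s + (k ∸ 1)                                        ≡⟨ as-sum ⟩
        ∑ k (except s (λ i → 2 * (n i ∸ 1) + 2 * n s + 1))      ≤⟨ ∑-except-mono-≤ k s other-term ⟩
        ∑ k (except s (λ i → term i + n s))                      ≡⟨ trans (∑-except-distrib-+ k s term (λ _ → n s))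
                                                                      (cong (∑ k (except s term) +_) (∑-except-const k s (n s))) ⟩
        ∑ k (except s term) + (k ∸ 1) * n s                      ≤⟨ +-monoʳ-≤ (∑ k (except s term)) center ⟩
        ∑ k (except s term) + term s                             ≡⟨ +-comm _ (term s) ⟩
        term s + ∑ k (except s term)                             ≡⟨ trans (arcs-complete D q0≡) (∑-split k term s) ⟨
        arcsOf D                                                 ∎
        where
        open ≤-Reasoning
        center : (k ∸ 1) * n s ≤ term s
        center rewrite Qs≡ = subst (_≤ n s * reachSum s) (*-comm (n s) (k ∸ 1)) (*-monoʳ-≤ (n s) (reachSum≥k-1 s))
        other-term : ∀ i → i ≢ s → 2 * (n i ∸ 1) + 2 * n s + 1 ≤ term i + n s
        other-term i i≢s = subst (_≤ term i + n s) (regroup (n i ∸ 1) (n s))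
          (+-monoˡ-≤ (n s) (≤-trans (+-monoʳ-≤ (2 * (n i ∸ 1)) reach-big)
            (term-≥ i (≤-trans (≤-trans (n≥2 s) (m≤m+n (n s) 1)) reach-big))))
          where
          regroup : ∀ a b → 2 * a + (b + 1) + b ≡ 2 * a + 2 * b + 1
          regroup = solve-∀
          third = another₂ k≥3 i s
          z = proj₁ third
          reach-big : n s + 1 ≤ reachSum i
          reach-big = ≤-trans (+-mono-≤ (≤-reflexive (sym (cong splitDeg Qs≡))) (deg≥1 z))
            (subst₂ (λ a b → a + b ≤ reachSum i) (except-other (deg D) (i≢s ∘ sym)) (except-other (deg D) (proj₁ (proj₂ third)))
              (∑-two-terms (except i (deg D)) s z (proj₂ (proj₂ third))))
        as-sum : arcs₁ s + (k ∸ 1) ≡ ∑ k (except s (λ i → 2 * (n i ∸ 1) + 2 * n s + 1))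
        as-sum = sym (trans (∑-except-distrib-+ k s _ _)
          (trans (cong₂ _+_ (∑-except-distrib-+ k s _ _) (∑-except-const k s 1))
            (trans (cong₂ (λ a b → a + b + (k ∸ 1) * 1) (∑-except-distribˡ-* k s 2 (λ i → n i ∸ 1)) (∑-except-const k s (2 * n s)))
              (regroup (∑ k (except s (λ i → n i ∸ 1))) (n s) (k ∸ 1)))))
          where
          regroup : ∀ S c u → 2 * S + u * (2 * c) + u * 1 ≡ 2 * (c * u + S) + u
          regroup = solve-∀

      arcs₂-<-two-centers : ∀ s s′ → s′ ≢ s → Q D s ≡ starCenter → Q D s′ ≡ starCenter → arcs₂ + 1 ≤ arcsOf D
      arcs₂-<-two-centers s s′ s′≢s Qs≡ Qs′≡ = subst (arcs₂ + 1 ≤_) (sym (arcs-complete D q0≡)) (∑-bump k s 1 each bump)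
        where
        each : ∀ i → 2 * (n i ∸ 1) + (k ∸ 1) ≤ term i
        each i = ≤-trans (+-monoʳ-≤ _ (reachSum≥k-1 i)) (term-≥ i (≤-trans k-1≥2 (reachSum≥k-1 i)))
        reach-big : k ∸ 1 < reachSum s
        reach-big = subst (_< reachSum s) (trans (∑-except-const k s 1) (*-identityʳ _))
          (∑-except-mono-< k s s′ s′≢s (λ l _ → deg≥1 l) (subst (1 <_) (sym (cong splitDeg Qs′≡)) (n≥2 s′)))
        bump : 2 * (n s ∸ 1) + (k ∸ 1) + 1 ≤ term s
        bump = ≤-trans (≤-reflexive (+-assoc (2 * (n s ∸ 1)) (k ∸ 1) 1))
          (≤-trans (+-monoʳ-≤ _ (subst (_≤ reachSum s) (+-comm 1 (k ∸ 1)) reach-big))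
            (term-≥ s (≤-trans k-1≥2 (<⇒≤ reach-big))))

      arcs-all-spokes : (∀ i → isSpoke (Q D i) ≡ true) → arcsOf D ≡ arcs₂
      arcs-all-spokes spokes = trans (arcs-complete D q0≡) (∑-cong k spoke-term-i)
        where
        deg≡1 : ∀ l → deg D l ≡ 1
        deg≡1 l with Q D l | spokes l
        ... | starSpoke c | _ = refl
        regroup : ∀ t u → t + t + 1 * u ≡ 2 * t + u
        regroup = solve-∀
        spoke-term-i : ∀ i → term i ≡ 2 * (n i ∸ 1) + (k ∸ 1)
        spoke-term-i i with Q D i | spokes i | deg≡1 i
        ... | starSpoke c | _ | _ = trans (regroup (n i ∸ 1) (reachSum i))
          (cong (2 * (n i ∸ 1) +_) (trans (∑-except-cong k i (λ l _ → deg≡1 l)) (trans (∑-except-const k i 1) (*-identityʳ _))))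

    edges₁-split : ∀ y → edges₁ y + (n y ∸ 1) ≡ n y * (k ∸ 1) + pendants
    edges₁-split y = trans (regroup (n y * (k ∸ 1)) _ (n y ∸ 1)) (cong (n y * (k ∸ 1) +_) (sym (∑-split k _ y)))
      where
      regroup : ∀ a r t → a + r + t ≡ a + (t + r)
      regroup = solve-∀

    edges₁-shift : ∀ x y → n y ≤ n x → edges₁ x ≡ edges₁ y + (k ∸ 2) * (n x ∸ n y)
    edges₁-shift x y y≤x = +-cancelʳ-≡ (n y ∸ 1 + d) _ _ (begin
      edges₁ x + (t + d)                   ≡⟨ cong (edges₁ x +_) nx∸1 ⟨
      edges₁ x + (n x ∸ 1)                 ≡⟨ edges₁-split x ⟩
      n x * (k ∸ 1) + pendants             ≡⟨ cong₂ (λ a b → a * b + pendants) nx k∸1 ⟩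
      (suc t + d) * suc u + pendants       ≡⟨ expand t d u pendants ⟩
      suc t * suc u + pendants + (d + u * d) ≡⟨ cong (_+ (d + u * d)) (trans (edges₁-split y) (cong₂ (λ a b → a * b + pendants) ny k∸1)) ⟨
      edges₁ y + t + (d + u * d)           ≡⟨ regroup (edges₁ y) t d u ⟩
      edges₁ y + u * d + (t + d)           ∎)
      where
      open ≡-Reasoning
      t = n y ∸ 1
      d = n x ∸ n y
      u = k ∸ 2
      ny : n y ≡ suc t
      ny = sym (trans (+-comm 1 t) (m∸n+n≡m (n≥1 y)))
      nx : n x ≡ suc t + d
      nx = sym (trans (cong (_+ d) (sym ny)) (m+[n∸m]≡n y≤x))
      nx∸1 : n x ∸ 1 ≡ t + d
      nx∸1 = cong (_∸ 1) nx
      k∸1 : k ∸ 1 ≡ suc u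
      k∸1 = ∸1≡suc∸2 k (≤-trans (s≤s (s≤s z≤n)) k≥3)
        where
        ∸1≡suc∸2 : ∀ m → 2 ≤ m → m ∸ 1 ≡ suc (m ∸ 2)
        ∸1≡suc∸2 (suc zero) (s≤s ())
        ∸1≡suc∸2 (suc (suc m)) _ = refl
      expand : ∀ t d u P → (suc t + d) * suc u + P ≡ suc t * suc u + P + (d + u * d)
      expand = solve-∀
      regroup : ∀ E t d u → E + t + (d + u * d) ≡ E + u * d + (t + d)
      regroup = solve-∀

    edges₁-mono : ∀ x y → n y ≤ n x → edges₁ y ≤ edges₁ x
    edges₁-mono x y y≤x = subst (edges₁ y ≤_) (sym (edges₁-shift x y y≤x)) (m≤m+n _ _)

    edges₁-cong : ∀ x y → n x ≡ n y → edges₁ x ≡ edges₁ y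
    edges₁-cong x y nx≡ny = trans (edges₁-shift x y (≤-reflexive (sym nx≡ny)))
      (trans (cong (λ z → edges₁ y + (k ∸ 2) * z) (trans (cong (_∸ n y) nx≡ny) (n∸n≡0 (n y))))
        (trans (cong (edges₁ y +_) (*-zeroʳ (k ∸ 2))) (+-identityʳ (edges₁ y))))

    edges₁-≤⇒≡ : ∀ x y → n y ≤ n x → edges₁ x ≤ edges₁ y → n x ≡ n y
    edges₁-≤⇒≡ x y y≤x x≤y = ≤-antisym (m∸n≡0⇒m≤n gap≡0) y≤x
      where
      u≥1 : 1 ≤ k ∸ 2
      u≥1 = ∸-monoˡ-≤ 2 k≥3
      product≡0 : (k ∸ 2) * (n x ∸ n y) ≡ 0
      product≡0 = n≤0⇒n≡0 (+-cancelˡ-≤ (edges₁ y) _ _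
        (subst (_≤ edges₁ y + 0) (edges₁-shift x y y≤x) (subst (edges₁ x ≤_) (sym (+-identityʳ _)) x≤y)))
      gap≡0 : n x ∸ n y ≡ 0
      gap≡0 with m*n≡0⇒m≡0∨n≡0 (k ∸ 2) product≡0
      ... | inj₁ u≡0 with () ← subst (1 ≤_) u≡0 u≥1
      ... | inj₂ d≡0 = d≡0

    arcs₁-mono : ∀ x y → n y ≤ n x → arcs₁ y ≤ arcs₁ x
    arcs₁-mono x y y≤x = *-monoʳ-≤ 2 (edges₁-mono x y y≤x)

    arcs₁-≤⇒≡ : ∀ x y → n y ≤ n x → arcs₁ x ≤ arcs₁ y → n x ≡ n y
    arcs₁-≤⇒≡ x y y≤x x≤y = edges₁-≤⇒≡ x y y≤x (*-cancelˡ-≤ 2 x≤y)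

    arcs₃-mono : ∀ x y → n y ≤ n x → arcs₃ y ≤ arcs₃ x
    arcs₃-mono x y y≤x = +-mono-≤ (arcs₁-mono x y y≤x) (*-mono-≤ y≤x (∸-monoˡ-≤ 1 y≤x))

    arcs₃-≤⇒≡ : ∀ x y → n y ≤ n x → arcs₃ x ≤ arcs₃ y → n x ≡ n y
    arcs₃-≤⇒≡ x y y≤x x≤y = arcs₁-≤⇒≡ x y y≤x
      (+-cancelʳ-≤ (n y * (n y ∸ 1)) _ _ (≤-trans (+-monoʳ-≤ (arcs₁ x) (*-mono-≤ y≤x (∸-monoˡ-≤ 1 y≤x))) x≤y))

    arcs₃-cong : ∀ x y → n x ≡ n y → arcs₃ x ≡ arcs₃ y
    arcs₃-cong x y nx≡ny = cong₂ _+_ (cong (2 *_) (edges₁-cong x y nx≡ny)) (cong (λ m → m * (m ∸ 1)) nx≡ny)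

  -- Classification of the decompositions in the orbit

  isCenter⇒starCenter : ∀ {m} (q : QiType m) → isCenter q ≡ true → q ≡ starCenter
  isCenter⇒starCenter starCenter _ = refl

  isSpoke⇒IsStarSpoke : ∀ {m} (q : QiType m) → isSpoke q ≡ true → IsStarSpoke q
  isSpoke⇒IsStarSpoke (starSpoke c) _ = c , refl

  IsStarSpoke⇒isSpoke : ∀ {m} {q : QiType m} → IsStarSpoke q → isSpoke q ≡ true
  IsStarSpoke⇒isSpoke (c , refl) = refl

  not-spoke-not-center⇒complete : ∀ {m} (q : QiType m) → isSpoke q ≡ false → isCenter q ≡ false → q ≡ complete
  not-spoke-not-center⇒complete complete _ _ = refl

  not-spoke-not-complete⇒center : ∀ {m} (q : QiType m) → isSpoke q ≡ false → isComplete q ≡ false → q ≡ starCenter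
  not-spoke-not-complete⇒center starCenter _ _ = refl

  not-complete-not-center⇒spoke : ∀ {m} (q : QiType m) → isComplete q ≡ false → isCenter q ≡ false → isSpoke q ≡ true
  not-complete-not-center⇒spoke (starSpoke c) _ _ = refl

  isEven-∸1 : ∀ k → 1 ≤ k → isEven (k ∸ 1) ≡ not (isEven k)
  isEven-∸1 (suc k) _ = sym (not-involutive (isEven k))

  isEven-%2 : ∀ m → m % 2 ≡ (if isEven m then 0 else 1)
  isEven-%2 zero = refl
  isEven-%2 (suc zero) = refl
  isEven-%2 (suc (suc m)) = trans (trans (cong (_% 2) (+-comm 2 m)) ([m+n]%n≡m%n m 2))
    (trans (isEven-%2 m) (cong (λ b → if b then 0 else 1) (sym (not-involutive (isEven m)))))

  %2≡0⇒isEven : ∀ m → m % 2 ≡ 0 → isEven m ≡ true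
  %2≡0⇒isEven m m%2≡0 with isEven m | isEven-%2 m
  ... | true | _ = refl
  ... | false | m%2≡1 with () ← trans (sym m%2≡1) m%2≡0

  %2≡1⇒isOdd : ∀ m → m % 2 ≡ 1 → isEven m ≡ false
  %2≡1⇒isOdd m m%2≡1 with isEven m | isEven-%2 m
  ... | false | _ = refl
  ... | true | m%2≡0 with () ← trans (sym m%2≡0) m%2≡1

  module _ {k : ℕ} {n : Fin k → ℕ} where

    spokeCount-all : ∀ (Q : (i : Fin k) → QiType (n i)) → (∀ i → isSpoke (Q i) ≡ true) → spokeCount Q ≡ k
    spokeCount-all Q spokes = trans (∑-cong k (λ i → cong ⟦_⟧ (spokes i))) (∑-ones k)

    spokeCount-allBut : ∀ (Q : (i : Fin k) → QiType (n i)) x → isSpoke (Q x) ≡ false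
      → (∀ i → i ≢ x → isSpoke (Q i) ≡ true) → spokeCount Q ≡ k ∸ 1
    spokeCount-allBut Q x x-notSpoke spokes = trans (∑-split k _ x)
      (trans (cong (λ b → ⟦ b ⟧ + ∑ k (except x (λ i → ⟦ isSpoke (Q i) ⟧))) x-notSpoke)
        (trans (∑-except-cong k x (λ i i≢x → cong ⟦_⟧ (spokes i i≢x))) (trans (∑-except-const k x 1) (*-identityʳ _))))

  module Classification {k : ℕ} {n : Fin k → ℕ} (k≥3 : 3 ≤ k) (n≥2 : ∀ i → 2 ≤ n i) where
    open Targets k≥3 n≥2

    EvenOutcome OddOutcome : SplitDec k n → Set
    EvenOutcome D = (∃ λ x → Shape1 x D × arcsOf D ≡ arcs₁ x) ⊎ (∃ λ y → arcs₁ y + 1 ≤ arcsOf D)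
    OddOutcome D = (Shape2 D × arcsOf D ≡ arcs₂) ⊎ (arcs₂ + 1 ≤ arcsOf D)
      ⊎ (∃ λ x → Shape3 x D × arcsOf D ≡ arcs₃ x) ⊎ (∃ λ y → arcs₃ y + 1 ≤ arcsOf D)

    k≥1 : 1 ≤ k
    k≥1 = ≤-trans (s≤s z≤n) k≥3

    other-nonSpoke : (D : SplitDec k n) (x : Fin k)
      → (∃ λ l → l ≢ x × isSpoke (Q D l) ≡ false) ⊎ (∀ i → i ≢ x → isSpoke (Q D i) ≡ true)
    other-nonSpoke D x with any? (λ i → ¬? (i ≟ x) ×-dec (isSpoke (Q D i) Bool.≟ false))
    ... | yes found = inj₁ found
    ... | no none = inj₂ λ i i≢x → ¬-not (λ notSpoke → none (i , i≢x , notSpoke))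

    with-center : (D : SplitDec k n) → (∃ λ s → isCenter (Q D s) ≡ true) ⊎ (∀ i → isCenter (Q D i) ≡ false)
    with-center D with any? (λ i → isCenter (Q D i) Bool.≟ true)
    ... | yes found = inj₁ found
    ... | no none = inj₂ λ i → ¬-not (λ center → none (i , center))

    other-center : (D : SplitDec k n) (s : Fin k)
      → (∃ λ s′ → s′ ≢ s × isCenter (Q D s′) ≡ true) ⊎ (∀ i → i ≢ s → isCenter (Q D i) ≡ false)
    other-center D s with any? (λ i → ¬? (i ≟ s) ×-dec (isCenter (Q D i) Bool.≟ true))
    ... | yes found = inj₁ found
    ... | no none = inj₂ λ i i≢s → ¬-not (λ center → none (i , i≢s , center))

    classify-even : isEven k ≡ true → (D : SplitDec k n) → OrbitInvariant D → EvenOutcome D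
    classify-even k-even D@(splitDec complete Qf) (noComplete , odd) with with-center D
    ... | inj₁ (s , center) = inj₂ (s , CompleteBounds.arcs₁-<-center D refl noComplete s (isCenter⇒starCenter _ center))
    ... | inj₂ noCenter = ⊥-elim (true≢false (trans (sym k-even) (trans (cong isEven (sym all-spokes)) odd)))
      where
      all-spokes : spokeCount Qf ≡ k
      all-spokes = spokeCount-all Qf (λ i → not-complete-not-center⇒spoke (Qf i) (noComplete i) (noCenter i))
    classify-even k-even D@(splitDec (starTowards x) Qf) (x-notSpoke , noCenter , _) = by-kind (Qf x) refl
      where
      open StarBounds D x refl x-notSpoke noCenter
      by-kind : (q : QiType (n x)) → Qf x ≡ q → EvenOutcome D
      by-kind (starSpoke c) e with () ← trans (cong isSpoke (sym e)) x-notSpoke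
      by-kind complete e =
        inj₂ (x , ≤-trans (+-monoʳ-≤ (arcs₁ x) inner≥1) (subst (_≤ arcsOf D) (+-comm (inner D x) (arcs₁ x)) arcs₁-≤))
        where
        inner≥1 : 1 ≤ inner D x
        inner≥1 rewrite e = *-mono-≤ (n≥1 x) (∸-monoˡ-≤ 1 (n≥2 x))
      by-kind starCenter e with other-nonSpoke D x
      ... | inj₁ (l , l≢x , l-notSpoke) =
        inj₂ (x , subst (λ z → z + arcs₁ x + 1 ≤ arcsOf D) (cong innerArcs e)
          (arcs₁-<-complete l l≢x (not-spoke-not-center⇒complete (Qf l) l-notSpoke (noCenter l l≢x))))
      ... | inj₂ spokes = inj₁ (x , (refl , e , λ i i≢x → isSpoke⇒IsStarSpoke (Qf i) (spokes i i≢x)) ,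
        trans (arcs-spokes spokes) (cong (λ q → innerArcs q + arcs₁ x) e))

    classify-odd : isEven k ≡ false → (D : SplitDec k n) → OrbitInvariant D → OddOutcome D
    classify-odd k-odd D@(splitDec complete Qf) (noComplete , odd) with with-center D
    ... | inj₂ noCenter =
      inj₁ ((refl , λ i → isSpoke⇒IsStarSpoke (Qf i) (spokes i)) , CompleteBounds.arcs-all-spokes D refl noComplete spokes)
      where
      spokes : ∀ i → isSpoke (Qf i) ≡ true
      spokes i = not-complete-not-center⇒spoke (Qf i) (noComplete i) (noCenter i)
    ... | inj₁ (s , s-center) with other-center D s
    ...   | inj₁ (s′ , s′≢s , s′-center) = inj₂ (inj₁ (CompleteBounds.arcs₂-<-two-centers D refl noComplete s s′ s′≢s
      (isCenter⇒starCenter _ s-center) (isCenter⇒starCenter _ s′-center)))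
    ...   | inj₂ noOther =
      ⊥-elim (true≢false (trans (sym (trans (isEven-∸1 k k≥1) (cong not k-odd))) (trans (cong isEven (sym all-but-s)) odd)))
      where
      all-but-s : spokeCount Qf ≡ k ∸ 1
      all-but-s = spokeCount-allBut Qf s (cong isSpoke (isCenter⇒starCenter _ s-center))
        (λ i i≢s → not-complete-not-center⇒spoke (Qf i) (noComplete i) (noOther i i≢s))
    classify-odd k-odd D@(splitDec (starTowards x) Qf) (x-notSpoke , noCenter , parity) = by-kind (Qf x) refl
      where
      open StarBounds D x refl x-notSpoke noCenter
      by-kind : (q : QiType (n x)) → Qf x ≡ q → OddOutcome D
      by-kind (starSpoke c) e with () ← trans (cong isSpoke (sym e)) x-notSpoke
      by-kind complete e with other-nonSpoke D x
      ... | inj₁ (l , l≢x , l-notSpoke) = inj₂ (inj₂ (inj₂ (x , subst (_≤ arcsOf D) regrouped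
        (arcs₁-<-complete l l≢x (not-spoke-not-center⇒complete (Qf l) l-notSpoke (noCenter l l≢x))))))
        where
        regrouped : inner D x + arcs₁ x + 1 ≡ arcs₃ x + 1
        regrouped rewrite e = cong (_+ 1) (+-comm _ (arcs₁ x))
      ... | inj₂ spokes = inj₂ (inj₂ (inj₁ (x , (refl , e , λ i i≢x → isSpoke⇒IsStarSpoke (Qf i) (spokes i i≢x)) ,
        trans (arcs-spokes spokes) (trans (+-comm (inner D x) (arcs₁ x)) (cong (λ q → arcs₁ x + innerArcs q) e)))))
      by-kind starCenter e with other-nonSpoke D x
      ... | inj₁ (l , l≢x , l-notSpoke) with n x ≤? n l
      ...   | yes x≤l = inj₂ (inj₂ (inj₂ (x , arcs₃-<-center-complete-≤ e l l≢x Ql≡ x≤l)))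
        where Ql≡ = not-spoke-not-center⇒complete (Qf l) l-notSpoke (noCenter l l≢x)
      ...   | no x≰l = inj₂ (inj₂ (inj₂ (l , arcs₃-<-center-complete-> e l l≢x Ql≡ (≰⇒> x≰l))))
        where Ql≡ = not-spoke-not-center⇒complete (Qf l) l-notSpoke (noCenter l l≢x)
      by-kind starCenter e | inj₂ spokes =
        ⊥-elim (true≢false (trans (sym (trans (isEven-∸1 k k≥1) (cong not k-odd)))
          (trans (cong isEven (sym (spokeCount-allBut Qf x x-notSpoke spokes))) (trans parity (cong isComplete e)))))

  module Formulas {k : ℕ} {n : Fin k → ℕ} (k≥3 : 3 ≤ k) (n≥2 : ∀ i → 2 ≤ n i) where
    open Targets k≥3 n≥2

    edges₂ : ℕ
    edges₂ = (k * (k ∸ 1)) / 2 + sumFin k (λ i → n i ∸ 1)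

    edges₃ : Fin k → ℕ
    edges₃ y = n y * (k ∸ 1) + (n y * (n y ∸ 1)) / 2 + sumExcept k y (λ i → n i ∸ 1)

    arcs₂≡ : arcs₂ ≡ k * (k ∸ 1) + 2 * pendants
    arcs₂≡ = trans (∑-distrib-+ k (λ i → 2 * (n i ∸ 1)) (λ _ → k ∸ 1))
      (trans (cong₂ _+_ (∑-distribˡ-* k 2 (λ i → n i ∸ 1)) (∑-const k (k ∸ 1))) (+-comm (2 * pendants) (k * (k ∸ 1))))

    edges₁≡ : ∀ y → n y * (k ∸ 1) + sumExcept k y (λ i → n i ∸ 1) ≡ edges₁ y
    edges₁≡ y = cong (n y * (k ∸ 1) +_) (sumExcept≡∑ k y _)

    edges₂+edges₂≡arcs₂ : edges₂ + edges₂ ≡ arcs₂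
    edges₂+edges₂≡arcs₂ = trans (regroup ((k * (k ∸ 1)) / 2) (sumFin k (λ i → n i ∸ 1)))
      (trans (cong₂ _+_ (2*[x*[x∸1]/2] k (≤-trans (s≤s z≤n) k≥3)) (cong (2 *_) (sumFin≡∑ k _))) (sym arcs₂≡))
      where
      regroup : ∀ a b → a + b + (a + b) ≡ 2 * a + 2 * b
      regroup = solve-∀

    edges₃+edges₃≡arcs₃ : ∀ y → edges₃ y + edges₃ y ≡ arcs₃ y
    edges₃+edges₃≡arcs₃ y = trans (regroup (n y * (k ∸ 1)) ((n y * (n y ∸ 1)) / 2) (sumExcept k y (λ i → n i ∸ 1)))
      (cong₂ _+_ (cong (2 *_) (edges₁≡ y)) (2*[x*[x∸1]/2] (n y) (n≥1 y)))
      where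
      regroup : ∀ a b c → a + b + c + (a + b + c) ≡ 2 * (a + c) + 2 * b
      regroup = solve-∀

    f₊ : Fin k → ℕ
    f₊ y = (n y ∸ 1) * (k ∸ 1) + ((n y ∸ 2) * (n y ∸ 1)) / 2

    f₋ : ℕ
    f₋ = ((k ∸ 2) * (k ∸ 1)) / 2

    -- Twice f(k, n_y) is arcs₃ y − arcs₂.
    arcs₃+2f₋≡arcs₂+2f₊ : ∀ y → arcs₃ y + 2 * f₋ ≡ arcs₂ + 2 * f₊ y
    arcs₃+2f₋≡arcs₂+2f₊ y = trans (identity (n y) k (∑ k (except y (λ i → n i ∸ 1))) (n≥2 y) k≥3)
      (trans (cong (λ z → k * (k ∸ 1) + 2 * z + 2 * f₊ y) (sym (∑-split k (λ i → n i ∸ 1) y)))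
        (cong (_+ 2 * f₊ y) (sym arcs₂≡)))
      where
      identity : ∀ m k′ S → 2 ≤ m → 3 ≤ k′
        → 2 * (m * (k′ ∸ 1) + S) + m * (m ∸ 1) + 2 * (((k′ ∸ 2) * (k′ ∸ 1)) / 2)
          ≡ k′ * (k′ ∸ 1) + 2 * ((m ∸ 1) + S) + 2 * ((m ∸ 1) * (k′ ∸ 1) + ((m ∸ 2) * (m ∸ 1)) / 2)
      identity (suc zero) _ _ (s≤s ()) _
      identity (suc (suc a)) (suc zero) _ _ (s≤s ())
      identity (suc (suc a)) (suc (suc zero)) _ _ (s≤s (s≤s ()))
      identity (suc (suc a)) (suc (suc (suc t))) S _ _ = begin
        2 * ((2 + a) * (2 + t) + S) + (2 + a) * suc a + 2 * ((suc t * (2 + t)) / 2)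
          ≡⟨ cong (2 * ((2 + a) * (2 + t) + S) + (2 + a) * suc a +_) (2*[x*[1+x]/2] (suc t)) ⟩
        2 * ((2 + a) * (2 + t) + S) + (2 + a) * suc a + suc t * (2 + t)
          ≡⟨ polynomial a t S ⟩
        (3 + t) * (2 + t) + 2 * (suc a + S) + (2 * (suc a * (2 + t)) + a * suc a)
          ≡⟨ cong (λ z → (3 + t) * (2 + t) + 2 * (suc a + S) + (2 * (suc a * (2 + t)) + z)) (2*[x*[1+x]/2] a) ⟨
        (3 + t) * (2 + t) + 2 * (suc a + S) + (2 * (suc a * (2 + t)) + 2 * ((a * suc a) / 2))
          ≡⟨ cong ((3 + t) * (2 + t) + 2 * (suc a + S) +_) (*-distribˡ-+ 2 (suc a * (2 + t)) _) ⟨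
        (3 + t) * (2 + t) + 2 * (suc a + S) + 2 * (suc a * (2 + t) + (a * suc a) / 2) ∎
        where
        open ≡-Reasoning
        polynomial : ∀ a t S → 2 * ((2 + a) * (2 + t) + S) + (2 + a) * suc a + suc t * (2 + t)
          ≡ (3 + t) * (2 + t) + 2 * (suc a + S) + (2 * (suc a * (2 + t)) + a * suc a)
        polynomial = solve-∀

    f>0⇒arcs₂<arcs₃ : ∀ y → ℤ.+ 0 ℤ.< f k (n y) → arcs₂ < arcs₃ y
    f>0⇒arcs₂<arcs₃ y f>0 = +-cancelʳ-< (2 * f₋) arcs₂ (arcs₃ y)
      (subst (arcs₂ + 2 * f₋ <_) (sym (arcs₃+2f₋≡arcs₂+2f₊ y)) (+-monoʳ-< arcs₂ (*-monoʳ-< 2 (difference-pos (f₊ y) f₋ f>0))))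

    f<0⇒arcs₃<arcs₂ : ∀ y → f k (n y) ℤ.< ℤ.+ 0 → arcs₃ y < arcs₂
    f<0⇒arcs₃<arcs₂ y f<0 = +-cancelʳ-< (2 * f₋) (arcs₃ y) arcs₂
      (subst (_< arcs₂ + 2 * f₋) (sym (arcs₃+2f₋≡arcs₂+2f₊ y)) (+-monoʳ-< arcs₂ (*-monoʳ-< 2 (difference-neg (f₊ y) f₋ f<0))))

    f≡0⇒arcs₃≡arcs₂ : ∀ y → f k (n y) ≡ ℤ.+ 0 → arcs₃ y ≡ arcs₂
    f≡0⇒arcs₃≡arcs₂ y f≡0 = +-cancelʳ-≡ (2 * f₋) (arcs₃ y) arcs₂
      (trans (arcs₃+2f₋≡arcs₂+2f₊ y) (cong (λ z → arcs₂ + 2 * z) (difference-zero (f₊ y) f₋ f≡0)))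

  +-self-injective : ∀ a b → a + a ≡ b + b → a ≡ b
  +-self-injective a b e = *-cancelˡ-≡ a b 2 (trans (cong (a +_) (+-identityʳ a)) (trans e (cong (b +_) (sym (+-identityʳ b)))))

  module MinimalGraph {k : ℕ} {n : Fin k → ℕ} (k≥3 : 3 ≤ k) (n≥2 : ∀ i → 2 ≤ n i)
    (r j : Fin k) (j-min : ∀ i → n j ≤ n i) (G : Graph k n) (G∈O : G ∈Orbit CS k n r) (G-min : ∀ H → H ∈Orbit CS k n r → edges G ≤ edges H)
    (D : SplitDec k n) (G≈D : HasSplitDec G D) where
    open Targets k≥3 n≥2
    open Classification k≥3 n≥2
    open Formulas k≥3 n≥2
    open Witnesses n≥2

    D-invariant : OrbitInvariant D
    D-invariant with orbit-splitDec r G G∈O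
    ... | D₀ , inv₀ , G≈D₀ with splitDec-unique k≥3 n≥2 D₀ D (λ u w → trans (sym (G≈D₀ u w)) (G≈D u w))
    ...   | Q0≡ , Q≡ = subst (λ q → Invariant q (Q D)) Q0≡ (Invariant-cong (Q0 D₀) (λ i → sym (Q≡ i)) inv₀)

    2edges≡arcs : edges G + edges G ≡ arcsOf D
    2edges≡arcs = edges+edges≡arcs-reconstruct G D G≈D

    arcs-minimal : ∀ vs → arcsOf D ≤ arcsOf (lcSplitDecs vs (cliqueStarDec n r))
    arcs-minimal vs = subst₂ _≤_ 2edges≡arcs
      (edges+edges≡arcs-reconstruct (lcs vs (CS k n r)) _ (lcs-reconstruct vs _ _ (CS-splitDec n r)))
      (+-mono-≤ (G-min _ (lcs-∈Orbit r vs)) (G-min _ (lcs-∈Orbit r vs)))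

    edges-from-arcs : ∀ {e} → arcsOf D ≡ e + e → edges G ≡ e
    edges-from-arcs {e} arcs≡ = +-self-injective (edges G) e (trans 2edges≡arcs arcs≡)

    vs : List (Vtx k n)
    vs = proj₁ (spoke-witness r j)

    W : SplitDec k n
    W = lcSplitDecs vs (cliqueStarDec n r)

    W-q0 : Q0 W ≡ starTowards j
    W-q0 = proj₁ (proj₂ (spoke-witness r j))

    W-spokes : ∀ i → i ≢ j → isSpoke (Q W i) ≡ true
    W-spokes i i≢j = cong isSpoke (proj₂ (proj₂ (spoke-witness r j)) i i≢j)

    W-invariant : Invariant (starTowards j) (Q W)
    W-invariant = subst (λ q → Invariant q (Q W)) W-q0 (lcSplitDecs-invariant vs _ (cliqueStarDec-invariant n r))

    W-j-notSpoke : isSpoke (Q W j) ≡ false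
    W-j-notSpoke = proj₁ W-invariant

    W-j-complete : isComplete (Q W j) ≡ not (isEven k)
    W-j-complete = trans (sym (proj₂ (proj₂ W-invariant)))
      (trans (cong isEven (spokeCount-allBut (Q W) j W-j-notSpoke W-spokes)) (isEven-∸1 k (≤-trans (s≤s z≤n) k≥3)))

    arcs-W : arcsOf W ≡ inner W j + arcs₁ j
    arcs-W = StarBounds.arcs-spokes W j W-q0 W-j-notSpoke (proj₁ (proj₂ W-invariant)) W-spokes

    arcs-≤-arcs₁ : isEven k ≡ true → arcsOf D ≤ arcs₁ j
    arcs-≤-arcs₁ k-even = subst (arcsOf D ≤_) (trans arcs-W (cong (λ q → innerArcs q + arcs₁ j) W-j≡center)) (arcs-minimal vs)
      where
      W-j≡center : Q W j ≡ starCenter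
      W-j≡center = not-spoke-not-complete⇒center (Q W j) W-j-notSpoke (trans W-j-complete (cong not k-even))

    module Odd (k-odd : isEven k ≡ false) where

      W-j≡complete : Q W j ≡ complete
      W-j≡complete = not-spoke-not-center⇒complete (Q W j) W-j-notSpoke
        (trans (sym (not-isComplete (Q W j) W-j-notSpoke)) (cong not (trans W-j-complete (cong not k-odd))))

      arcs-≤-arcs₃ : arcsOf D ≤ arcs₃ j
      arcs-≤-arcs₃ = subst (arcsOf D ≤_)
        (trans arcs-W (trans (cong (λ q → innerArcs q + arcs₁ j) W-j≡complete) (+-comm _ (arcs₁ j)))) (arcs-minimal vs)

      W₂-shape : Shape2 (lcSplitDec (leafVtx j) W)
      W₂-shape = lc-complete-center j W W-q0 W-j≡complete (λ i i≢j → isSpoke⇒IsStarSpoke _ (W-spokes i i≢j))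

      arcs-≤-arcs₂ : arcsOf D ≤ arcs₂
      arcs-≤-arcs₂ = subst (arcsOf D ≤_) (trans (cong arcsOf (lcSplitDecs-++ vs (leafVtx j ∷ []) (cliqueStarDec n r))) arcs-W₂)
        (arcs-minimal (vs ++ leafVtx j ∷ []))
        where
        spokes = λ i → IsStarSpoke⇒isSpoke (proj₂ W₂-shape i)
        arcs-W₂ : arcsOf (lcSplitDec (leafVtx j) W) ≡ arcs₂
        arcs-W₂ = CompleteBounds.arcs-all-spokes _ (proj₁ W₂-shape) (λ i → noComplete (proj₂ W₂-shape i)) spokes
          where
          noComplete : ∀ {m} {q : QiType m} → IsStarSpoke q → isComplete q ≡ false
          noComplete (c , refl) = refl

      outcome : OddOutcome D
      outcome = classify-odd k-odd D D-invariant

    ¬+1≤ : ∀ {a} → a + 1 ≤ a → ⊥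
    ¬+1≤ {a} a+1≤a = <-irrefl refl (subst (_≤ a) (+-comm a 1) a+1≤a)

    even-case : k % 2 ≡ 0 → Σ (Fin k) (λ j′ → (n j′ ≡ n j) × Shape1 j′ D)
      × (edges G ≡ n j * (k ∸ 1) + sumExcept k j (λ i → n i ∸ 1))
    even-case k%2≡0 = by-outcome (classify-even k-even D D-invariant)
      where
      k-even = %2≡0⇒isEven k k%2≡0
      by-outcome : EvenOutcome D → Σ (Fin k) (λ j′ → (n j′ ≡ n j) × Shape1 j′ D)
        × (edges G ≡ n j * (k ∸ 1) + sumExcept k j (λ i → n i ∸ 1))
      by-outcome (inj₂ (y , y<)) = ⊥-elim (¬+1≤ (≤-trans y< (≤-trans (arcs-≤-arcs₁ k-even) (arcs₁-mono y j (j-min y)))))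
      by-outcome (inj₁ (x , shape , arcs≡)) = (x , nx≡nj , shape) ,
        trans (edges-from-arcs (trans arcs≡ (cong (edges₁ x +_) (+-identityʳ (edges₁ x)))))
          (trans (edges₁-cong x j nx≡nj) (sym (edges₁≡ j)))
        where
        nx≡nj = arcs₁-≤⇒≡ x j (j-min x) (subst (_≤ arcs₁ j) arcs≡ (arcs-≤-arcs₁ k-even))

    odd-pos-case : k % 2 ≡ 1 → ℤ.+ 0 ℤ.< f k (n j) → Shape2 D × (edges G ≡ edges₂)
    odd-pos-case k%2≡1 f>0 = by-outcome outcome
      where
      open Odd (%2≡1⇒isOdd k k%2≡1)
      arcs₂<arcs₃ = f>0⇒arcs₂<arcs₃ j f>0
      by-outcome : OddOutcome D → Shape2 D × (edges G ≡ edges₂)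
      by-outcome (inj₁ (shape , arcs≡)) = shape , edges-from-arcs (trans arcs≡ (sym edges₂+edges₂≡arcs₂))
      by-outcome (inj₂ (inj₁ arcs₂<)) = ⊥-elim (¬+1≤ (≤-trans arcs₂< arcs-≤-arcs₂))
      by-outcome (inj₂ (inj₂ (inj₁ (x , _ , arcs≡)))) =
        ⊥-elim (<-irrefl refl (<-≤-trans arcs₂<arcs₃ (≤-trans (arcs₃-mono x j (j-min x)) (subst (_≤ arcs₂) arcs≡ arcs-≤-arcs₂))))
      by-outcome (inj₂ (inj₂ (inj₂ (y , arcs₃<)))) =
        ⊥-elim (<-irrefl refl (<-≤-trans arcs₂<arcs₃ (≤-trans (arcs₃-mono y j (j-min y)) (≤-trans (m≤m+n _ 1) (≤-trans arcs₃< arcs-≤-arcs₂)))))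

    odd-neg-case : k % 2 ≡ 1 → f k (n j) ℤ.< ℤ.+ 0
      → Σ (Fin k) (λ j′ → (n j′ ≡ n j) × Shape3 j′ D) × (edges G ≡ edges₃ j)
    odd-neg-case k%2≡1 f<0 = by-outcome outcome
      where
      open Odd (%2≡1⇒isOdd k k%2≡1)
      arcs₃<arcs₂ = f<0⇒arcs₃<arcs₂ j f<0
      by-outcome : OddOutcome D → Σ (Fin k) (λ j′ → (n j′ ≡ n j) × Shape3 j′ D) × (edges G ≡ edges₃ j)
      by-outcome (inj₁ (_ , arcs≡)) = ⊥-elim (<-irrefl refl (<-≤-trans arcs₃<arcs₂ (subst (_≤ arcs₃ j) arcs≡ arcs-≤-arcs₃)))
      by-outcome (inj₂ (inj₁ arcs₂<)) = ⊥-elim (<-irrefl refl (<-≤-trans arcs₃<arcs₂ (≤-trans (m≤m+n arcs₂ 1) (≤-trans arcs₂< arcs-≤-arcs₃))))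
      by-outcome (inj₂ (inj₂ (inj₁ (x , shape , arcs≡)))) = (x , nx≡nj , shape) ,
        edges-from-arcs (trans arcs≡ (trans (arcs₃-cong x j nx≡nj) (sym (edges₃+edges₃≡arcs₃ j))))
        where
        nx≡nj = arcs₃-≤⇒≡ x j (j-min x) (subst (_≤ arcs₃ j) arcs≡ arcs-≤-arcs₃)
      by-outcome (inj₂ (inj₂ (inj₂ (y , arcs₃<)))) = ⊥-elim (¬+1≤ (≤-trans arcs₃< (≤-trans arcs-≤-arcs₃ (arcs₃-mono y j (j-min y)))))

    odd-zero-case : k % 2 ≡ 1 → f k (n j) ≡ ℤ.+ 0
      → (edges₂ ≡ edges₃ j)
      × (∀ (H : Graph k n) (E : SplitDec k n) → H ∈Orbit CS k n r → HasSplitDec H E → Shape2 E → edges H ≡ edges G)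
      × (∀ (H : Graph k n) (E : SplitDec k n) → H ∈Orbit CS k n r → HasSplitDec H E
          → (j′ : Fin k) → n j′ ≡ n j → Shape3 j′ E → edges H ≡ edges G)
    odd-zero-case k%2≡1 f≡0 =
      +-self-injective edges₂ (edges₃ j) (trans edges₂+edges₂≡arcs₂ (trans (sym arcs₃≡arcs₂) (sym (edges₃+edges₃≡arcs₃ j)))) ,
      shape2-edges , shape3-edges
      where
      open Odd (%2≡1⇒isOdd k k%2≡1)
      arcs₃≡arcs₂ = f≡0⇒arcs₃≡arcs₂ j f≡0
      arcs₂-≤ : OddOutcome D → arcs₂ ≤ arcsOf D
      arcs₂-≤ (inj₁ (_ , arcs≡)) = ≤-reflexive (sym arcs≡)
      arcs₂-≤ (inj₂ (inj₁ arcs₂<)) = ≤-trans (m≤m+n arcs₂ 1) arcs₂<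
      arcs₂-≤ (inj₂ (inj₂ (inj₁ (x , _ , arcs≡)))) = subst₂ _≤_ arcs₃≡arcs₂ (sym arcs≡) (arcs₃-mono x j (j-min x))
      arcs₂-≤ (inj₂ (inj₂ (inj₂ (y , arcs₃<)))) = subst (_≤ arcsOf D) arcs₃≡arcs₂ (≤-trans (arcs₃-mono y j (j-min y)) (≤-trans (m≤m+n _ 1) arcs₃<))
      arcs≡arcs₂ : arcsOf D ≡ arcs₂
      arcs≡arcs₂ = ≤-antisym arcs-≤-arcs₂ (arcs₂-≤ outcome)
      same-edges : ∀ H E → HasSplitDec H E → arcsOf E ≡ arcs₂ → edges H ≡ edges G
      same-edges H E H≈E arcsE≡ = +-self-injective (edges H) (edges G)
        (trans (edges+edges≡arcs-reconstruct H E H≈E) (trans arcsE≡ (trans (sym arcs≡arcs₂) (sym 2edges≡arcs))))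
      spoke-not-complete : ∀ {m} {q : QiType m} → IsStarSpoke q → isComplete q ≡ false
      spoke-not-complete (c , refl) = refl
      spoke-not-center : ∀ {m} {q : QiType m} → IsStarSpoke q → isCenter q ≡ false
      spoke-not-center (c , refl) = refl
      shape2-edges : ∀ (H : Graph k n) (E : SplitDec k n) → H ∈Orbit CS k n r → HasSplitDec H E → Shape2 E → edges H ≡ edges G
      shape2-edges H E _ H≈E (q0≡ , spokes) = same-edges H E H≈E
        (CompleteBounds.arcs-all-spokes E q0≡ (λ i → spoke-not-complete (spokes i)) (λ i → IsStarSpoke⇒isSpoke (spokes i)))
      shape3-edges : ∀ (H : Graph k n) (E : SplitDec k n) → H ∈Orbit CS k n r → HasSplitDec H E
        → (j′ : Fin k) → n j′ ≡ n j → Shape3 j′ E → edges H ≡ edges G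
      shape3-edges H E _ H≈E j′ nj′≡nj (q0≡ , Qj′≡ , spokes) = same-edges H E H≈E (begin
        arcsOf E                   ≡⟨ StarBounds.arcs-spokes E j′ q0≡ (cong isSpoke Qj′≡) (λ i i≢j′ → spoke-not-center (spokes i i≢j′))
                                        (λ i i≢j′ → IsStarSpoke⇒isSpoke (spokes i i≢j′)) ⟩
        inner E j′ + arcs₁ j′      ≡⟨ trans (cong (λ q → innerArcs q + arcs₁ j′) Qj′≡) (+-comm _ (arcs₁ j′)) ⟩
        arcs₃ j′                   ≡⟨ arcs₃-cong j′ j nj′≡nj ⟩
        arcs₃ j                    ≡⟨ arcs₃≡arcs₂ ⟩
        arcs₂                      ∎)
        where open ≡-Reasoning

open import Defs
open import Data.Nat using (ℕ; _+_; _*_; _∸_; _≤_; _%_)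
open import Data.Nat.DivMod using (_/_)
open import Data.Integer using (ℤ; +_; _<_; _>_)
open import Data.Fin using (Fin)
open import Data.Product using (Σ; _×_; _,_)
open import Relation.Binary.PropositionalEquality using (_≡_)

theorem12 : (k : ℕ) → 3 ≤ k → (n : Fin k → ℕ) → (∀ i → 2 ≤ n i) → (r : Fin k)
  → (j : Fin k) → (∀ i → n j ≤ n i)
  → (G : Graph k n) → G ∈Orbit CS k n r
  → (∀ (H : Graph k n) → H ∈Orbit CS k n r → edges G ≤ edges H)
  → (D : SplitDec k n) → HasSplitDec G D
  → ((k % 2 ≡ 0)
      → Σ (Fin k) (λ j′ → (n j′ ≡ n j) × Shape1 j′ D)
        × (edges G ≡ n j * (k ∸ 1) + sumExcept k j (λ i → n i ∸ 1)))
  × ((k % 2 ≡ 1) → f k (n j) > + 0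
      → Shape2 D
        × (edges G ≡ (k * (k ∸ 1)) / 2 + sumFin k (λ i → n i ∸ 1)))
  × ((k % 2 ≡ 1) → f k (n j) < + 0
      → Σ (Fin k) (λ j′ → (n j′ ≡ n j) × Shape3 j′ D)
        × (edges G ≡ n j * (k ∸ 1) + (n j * (n j ∸ 1)) / 2 + sumExcept k j (λ i → n i ∸ 1)))
  × ((k % 2 ≡ 1) → f k (n j) ≡ + 0
      → ((k * (k ∸ 1)) / 2 + sumFin k (λ i → n i ∸ 1)
          ≡ n j * (k ∸ 1) + (n j * (n j ∸ 1)) / 2 + sumExcept k j (λ i → n i ∸ 1))
        × (∀ (H : Graph k n) (E : SplitDec k n) → H ∈Orbit CS k n r → HasSplitDec H E
            → Shape2 E → edges H ≡ edges G)
        × (∀ (H : Graph k n) (E : SplitDec k n) → H ∈Orbit CS k n r → HasSplitDec H E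
            → (j′ : Fin k) → n j′ ≡ n j → Shape3 j′ E → edges H ≡ edges G))
theorem12 k k≥3 n n≥2 r j j-min G G∈O G-min D G≈D =
  even-case , odd-pos-case , odd-neg-case , odd-zero-case
  where open CliqueStarOrbit.MinimalGraph k≥3 n≥2 r j j-min G G∈O G-min D G≈D
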